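{- Let $n$ be a power of two. For the online multiplication problem in base $q$ where both operands are chosen uniformly at random from $[q^n]$, for any deterministic cell-probe algorithm (possibly depending on the fixed operand) solving the problem, every node $v$ of the information transfer tree $\mathcal{T}$ has large information transfer, i.e. $\mathbb{E}[I_v]\ge \frac{k\cdot\delta\cdot\ell_v}{w}$ for a constant $k>0$ depending only on the problem and input distribution.
   Context: Framework: $\delta=\lfloor\log_2 q\rfloor$; cell-probe model with $w$-bit cells (a cell can store the address of any cell), cost = number of cell reads/writes. One operand $F\in[q^n]$ is known in advance; the base-$q$ digits $U[0],U[1],\dots,U[n-1]$ of the other operand $U\in[q^n]$ arrive one at a time, least significant first, and after arrival $t$ the algorithm outputs $A[t]$, the $t$-th least significant base-$q$ digit of $F\cdot U$, before the next arrival. Information transfer tree $\mathcal{T}$: a balanced binary tree with $n$ leaves representing arrivals $0,\dots,n-1$ from left to right. For a node $v$, $\ell_v$ is the number of leaves below $v$, $t_0$ its leftmost leaf, $t_1=t_0+\ell_v/2-1$, $t_2=t_0+\ell_v-1$. The information transfer $\mathcal{I}_v$ is the set of cells probed during the processing of arrivals $t_0,\dots,t_1$ and also probed during the processing of arrivals $t_1+1,\dots,t_2$; $I_v=|\mathcal{I}_v|$. The expectation is over the random input. -}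

module Defs where

open import Data.Nat using (ℕ; zero; suc; _+_; _*_; _∸_; _^_; _≤_; _<_; _≤ᵇ_; NonZero; >-nonZero)
import Data.Nat as ℕ
import Data.Nat.Properties as ℕP
import Data.Fin as Fin
open import Data.Nat.DivMod using (_/_; _%_)
open import Data.Nat.Logarithm using (⌊log₂_⌋)
open import Data.Fin using (Fin; toℕ; _≟_)
open import Data.Vec using (Vec; []; _∷_; lookup)
open import Data.List using (List; []; _∷_; _++_)
open import Data.Bool.ListAction using (any)
open import Data.Product using (_×_; _,_)
open import Data.Bool using (Bool; true; false; if_then_else_; _∧_)
open import Relation.Nullary.Decidable using (⌊_⌋)
open import Relation.Binary.PropositionalEquality using (_≡_)

δ : ℕ → ℕ
δ q = ⌊log₂ q ⌋

digit : (q : ℕ) → 2 ≤ q → ℕ → ℕ → ℕ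
digit q hq t x = _%_ (_/_ x (q ^ t) {{pow≢0 t}}) q {{nz}}
  where
  nz : NonZero q
  nz = >-nonZero (ℕP.≤-trans (ℕ.s≤s ℕ.z≤n) hq)
  pow≢0 : (t : ℕ) → NonZero (q ^ t)
  pow≢0 zero = _
  pow≢0 (suc t) = ℕP.m*n≢0 q (q ^ t) {{nz}} {{pow≢0 t}}

val : (q : ℕ) → {m : ℕ} → Vec (Fin q) m → ℕ
val q [] = 0
val q (d ∷ ds) = toℕ d + q * val q ds

-- Cell-probe model with w-bit cells.  Since a cell can hold the address
-- of any cell, the memory consists of the 2^w cells addressed by w-bit words.

Word : ℕ → Set
Word w = Fin (2 ^ w)

Memory : ℕ → Set
Memory w = Word w → Word w

data Prog (w : ℕ) (O : Set) : Set where
  ret   : O → Prog w O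
  read  : Word w → (Word w → Prog w O) → Prog w O
  write : Word w → Word w → Prog w O → Prog w O

update : (w : ℕ) → Memory w → Word w → Word w → Memory w
update w M a v b = if ⌊ b ≟ a ⌋ then v else M b

run : (w : ℕ) {O : Set} → Prog w O → Memory w → O × Memory w × List (Word w)
run w (ret o) M = o , M , []
run w (read a k) M with run w (k (M a)) M
... | o , M' , ps = o , M' , a ∷ ps
run w (write a v p) M with run w p (update w M a v)
... | o , M' , ps = o , M' , a ∷ ps

-- An online algorithm for base q with w-bit cells: an initial memory
-- (arbitrary preprocessing, free) and, for each arrival time t and
-- arriving digit, a cell-probe program that outputs the digit A[t].
-- The only state carried between arrivals is the memory.
record Alg (q w : ℕ) : Set where
  field
    initMem : Memory w
    step    : ℕ → Fin q → Prog w (Fin q)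

open Alg public

go : {q w m : ℕ} → Alg q w → ℕ → Memory w → Vec (Fin q) m → Vec (Fin q × List (Word w)) m
go A t M [] = []
go {w = w} A t M (d ∷ ds) with run w (step A t d) M
... | o , M' , ps = (o , ps) ∷ go A (suc t) M' ds

trace : {q w n : ℕ} → Alg q w → Vec (Fin q) n → Vec (Fin q × List (Word w)) n
trace A U = go A 0 (initMem A) U

Correct : (q : ℕ) → 2 ≤ q → (w n : ℕ) → (Fin (q ^ n) → Alg q w) → Set
Correct q hq w n alg =
  (F : Fin (q ^ n)) (U : Vec (Fin q) n) (t : Fin n) →
  toℕ (Data.Product.proj₁ (lookup (trace (alg F) U) t)) ≡ digit q hq (toℕ t) (toℕ F * val q U)

probesIn : {q : ℕ} (w : ℕ) {m : ℕ} → ℕ → ℕ → ℕ → Vec (Fin q × List (Word w)) m → List (Word w)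
probesIn w a b t [] = []
probesIn w a b t ((o , ps) ∷ rest) =
  (if (a ≤ᵇ t) ∧ (t ≤ᵇ b) then ps else []) ++ probesIn w a b (suc t) rest

memb : (w : ℕ) → Word w → List (Word w) → Bool
memb w a xs = any (λ b → ⌊ a ≟ b ⌋) xs

sumFin : (m : ℕ) → (Fin m → ℕ) → ℕ
sumFin zero f = 0
sumFin (suc m) f = f Fin.zero + sumFin m (λ i → f (Fin.suc i))

sumVec : (q m : ℕ) → (Vec (Fin q) m → ℕ) → ℕ
sumVec q zero f = f []
sumVec q (suc m) f = sumFin q (λ x → sumVec q m (λ u → f (x ∷ u)))

-- Nodes of the information transfer tree with n = 2^d leaves: the node at
-- height j (ℓ_v = 2^j leaves below it, 1 ≤ j ≤ d, i.e. internal nodes) and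
-- index i < 2^(d-j) from the left has t₀ = i·2^j, t₁ = t₀ + 2^(j-1) - 1,
-- t₂ = t₀ + 2^j - 1.
t₀ t₁ t₂ : ℕ → ℕ → ℕ
t₀ j i = i * 2 ^ j
t₁ j i = t₀ j i + 2 ^ (j ∸ 1) ∸ 1
t₂ j i = t₀ j i + 2 ^ j ∸ 1

I : {q w n : ℕ} → Alg q w → Vec (Fin q) n → ℕ → ℕ → ℕ
I {w = w} A U j i =
  sumFin (2 ^ w) (λ c →
    if memb w c (probesIn w (t₀ j i) (t₁ j i) 0 tr) ∧ memb w c (probesIn w (suc (t₁ j i)) (t₂ j i) 0 tr)
    then 1 else 0)
  where tr = trace A U

-- Σ over all (F, U) ∈ [q^n] × [q^n] of I_v; the expectation under the uniform
-- distribution is this total divided by q^n · q^n.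
totalI : (q w n : ℕ) → (Fin (q ^ n) → Alg q w) → ℕ → ℕ → ℕ
totalI q w n alg j i = sumFin (q ^ n) (λ F → sumVec q n (λ U → I (alg F) U j i))

-- Fix a node v, the operand F and all arrivals except the h = ℓ_v / 2 arrivals L of the left half
-- (R₁ denotes the arrivals of the right half).  The cells probed in both halves, with their contents
-- after the left half, form a certificate with I_v entries that determines the run on R₁, hence the
-- digits of F · U output during the right half.  These digits determine the middle block
-- ⌊((c + F L) mod Q²) / Q⌋, where Q = q^h and the carry c comes from the arrivals before the node,
-- and two values of L with the same middle block differ by an e < Q such that F e is congruent
-- modulo Q² to a number in (−Q, Q).  So a certificate is shared by at most 1 + 2 N_F values of L,
-- where N_F counts such e, while at most 2^((2w+1)k) certificates have k or fewer entries.  As N_F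
-- averages to at most 6 over F, the choice k ≈ δ h / (2w + 1) shows that most L have I_v > k;
-- if Q is small, the operands F ≡ Q (mod Q²), for which N_F = 0, give the bound instead.

module Submission where

open import Defs
open import Data.Bool using (Bool; true; false; _∧_; _∨_; if_then_else_)
open import Data.Bool.Properties using (∨-assoc; ∨-zeroʳ; ∧-zeroʳ; ∨-identityʳ; ∨-conicalˡ; ∨-conicalʳ)
open import Data.Empty using (⊥-elim)
open import Data.Fin using (Fin; toℕ; fromℕ<; _↑ˡ_; _↑ʳ_)
import Data.Fin as Fin
open import Data.Fin.Properties using (toℕ<n; toℕ-↑ˡ; toℕ-↑ʳ; toℕ-fromℕ<)
open import Data.List using (List; []; _∷_) renaming (_++_ to _++ₗ_)
open import Data.List.Properties using (++-assoc; ++-identityʳ)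
open import Data.Maybe using (Maybe; just; nothing; is-just)
import Data.Maybe.Properties as Maybeₚ
open import Data.Nat
open import Data.Nat.Properties
open import Data.Nat.DivMod
open import Data.Nat.Divisibility using (n∣m*n; m∣m*n)
open import Data.Nat.Induction using (<-wellFounded)
open import Data.Nat.Logarithm using (⌊log₂_⌋)
open import Data.Nat.Logarithm.Core using (⌊log2⌋)
open import Data.Nat.Tactic.RingSolver using (solve-∀)
open import Algebra.Properties.CommutativeSemigroup +-commutativeSemigroup
  using () renaming (interchange to +-interchange; x∙yz≈y∙xz to +-leftComm; xy∙z≈xz∙y to +-rightComm)
open import Data.Product using (Σ; _×_; _,_; proj₁; proj₂)
open import Data.Sum using (_⊎_; inj₁; inj₂)
open import Data.Vec using (Vec; []; _∷_; _++_; lookup; tabulate)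
import Data.Vec.Properties as Vecₚ
open import Function using (_∘_; _∘′_)
open import Induction.WellFounded using (Acc; acc)
open import Relation.Binary using (tri<; tri≈; tri>)
open import Relation.Binary.PropositionalEquality
open import Relation.Nullary using (Dec; yes; no; does; ¬_; contradiction)
open import Relation.Nullary.Decidable using (⌊_⌋; dec-true; dec-false; isYes≗does)

-- Finite sums

sumFin-cong : ∀ m {f g : Fin m → ℕ} → (∀ x → f x ≡ g x) → sumFin m f ≡ sumFin m g
sumFin-cong zero    f≗g = refl
sumFin-cong (suc m) f≗g = cong₂ _+_ (f≗g Fin.zero) (sumFin-cong m (f≗g ∘ Fin.suc))

sumFin-mono : ∀ m {f g : Fin m → ℕ} → (∀ x → f x ≤ g x) → sumFin m f ≤ sumFin m g
sumFin-mono zero    f≤g = z≤n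
sumFin-mono (suc m) f≤g = +-mono-≤ (f≤g Fin.zero) (sumFin-mono m (f≤g ∘ Fin.suc))

sumFin-+ : ∀ m (f g : Fin m → ℕ) → sumFin m (λ x → f x + g x) ≡ sumFin m f + sumFin m g
sumFin-+ zero    f g = refl
sumFin-+ (suc m) f g = trans (cong (f Fin.zero + g Fin.zero +_) (sumFin-+ m (f ∘ Fin.suc) (g ∘ Fin.suc)))
                             (+-interchange (f Fin.zero) (g Fin.zero) _ _)

sumFin-const : ∀ m c → sumFin m (λ _ → c) ≡ m * c
sumFin-const zero    c = refl
sumFin-const (suc m) c = cong (c +_) (sumFin-const m c)

sumFin-* : ∀ m c (f : Fin m → ℕ) → sumFin m (λ x → c * f x) ≡ c * sumFin m f
sumFin-* zero    c f = sym (*-zeroʳ c)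
sumFin-* (suc m) c f = trans (cong (c * f Fin.zero +_) (sumFin-* m c (f ∘ Fin.suc)))
                             (sym (*-distribˡ-+ c _ _))

sumFin-comm : ∀ a b (g : Fin a → Fin b → ℕ) →
  sumFin a (λ x → sumFin b (g x)) ≡ sumFin b (λ y → sumFin a (λ x → g x y))
sumFin-comm zero    b g = sym (trans (sumFin-const b 0) (*-zeroʳ b))
sumFin-comm (suc a) b g = trans (cong (sumFin b (g Fin.zero) +_) (sumFin-comm a b (g ∘ Fin.suc)))
                                (sym (sumFin-+ b (g Fin.zero) _))

sumFin-term : ∀ m (f : Fin m → ℕ) x → f x ≤ sumFin m f
sumFin-term (suc m) f Fin.zero    = m≤m+n _ _
sumFin-term (suc m) f (Fin.suc x) = ≤-trans (sumFin-term m (f ∘ Fin.suc) x) (m≤n+m _ _)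

sumFin-positive : ∀ m (f : Fin m → ℕ) → 0 < sumFin m f → Σ (Fin m) λ x → 0 < f x
sumFin-positive (suc m) f pos with f Fin.zero in eq
... | suc _ = Fin.zero , subst (0 <_) (sym eq) z<s
... | zero with sumFin-positive m (f ∘ Fin.suc) pos
...   | x , fx>0 = Fin.suc x , fx>0

sumBelow : ℕ → (ℕ → ℕ) → ℕ
sumBelow n f = sumFin n (f ∘ toℕ)

sumBelow-cong : ∀ n {f g : ℕ → ℕ} → (∀ x → x < n → f x ≡ g x) → sumBelow n f ≡ sumBelow n g
sumBelow-cong n f≗g = sumFin-cong n (λ x → f≗g (toℕ x) (toℕ<n x))

sumBelow-mono : ∀ n {f g : ℕ → ℕ} → (∀ x → x < n → f x ≤ g x) → sumBelow n f ≤ sumBelow n g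
sumBelow-mono n f≤g = sumFin-mono n (λ x → f≤g (toℕ x) (toℕ<n x))

sumBelow-zero : ∀ n (f : ℕ → ℕ) → (∀ x → x < n → f x ≡ 0) → sumBelow n f ≡ 0
sumBelow-zero n f f≗0 = trans (sumBelow-cong n f≗0) (trans (sumFin-const n 0) (*-zeroʳ n))

sumBelow-term : ∀ n (f : ℕ → ℕ) {x} → x < n → f x ≤ sumBelow n f
sumBelow-term (suc n) f {zero}  _         = m≤m+n _ _
sumBelow-term (suc n) f {suc x} (s≤s x<n) = ≤-trans (sumBelow-term n (f ∘ suc) x<n) (m≤n+m _ _)

sumBelow-split : ∀ a b (f : ℕ → ℕ) → sumBelow (a + b) f ≡ sumBelow a f + sumBelow b (λ x → f (a + x))
sumBelow-split zero    b f = refl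
sumBelow-split (suc a) b f = trans (cong (f 0 +_) (sumBelow-split a b (f ∘ suc))) (sym (+-assoc (f 0) _ _))

sumBelow-last : ∀ n (f : ℕ → ℕ) → sumBelow (suc n) f ≡ sumBelow n f + f n
sumBelow-last n f = trans (cong (λ m → sumBelow m f) (+-comm 1 n))
                          (trans (sumBelow-split n 1 f)
                                 (cong (sumBelow n f +_) (trans (+-identityʳ _) (cong f (+-identityʳ n)))))

sumBelow-digits : ∀ q M (f : ℕ → ℕ) → sumBelow M (λ y → sumBelow q (λ d → f (d + q * y))) ≡ sumBelow (q * M) f
sumBelow-digits q zero    f = cong (λ n → sumBelow n f) (sym (*-zeroʳ q))
sumBelow-digits q (suc M) f = begin
  sumBelow q (λ d → f (d + q * 0)) + sumBelow M (λ y → sumBelow q (λ d → f (d + q * suc y)))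
    ≡⟨ cong₂ _+_ (sumFin-cong q (λ d → cong f (trans (cong (toℕ d +_) (*-zeroʳ q)) (+-identityʳ (toℕ d)))))
                 (sumFin-cong M (λ y → sumFin-cong q (λ d → cong f (shift (toℕ d) (toℕ y))))) ⟩
  sumBelow q f + sumBelow M (λ y → sumBelow q (λ d → f (q + (d + q * y))))
    ≡⟨ cong (sumBelow q f +_) (sumBelow-digits q M (λ x → f (q + x))) ⟩
  sumBelow q f + sumBelow (q * M) (λ x → f (q + x))
    ≡⟨ sym (sumBelow-split q (q * M) f) ⟩
  sumBelow (q + q * M) f
    ≡⟨ cong (λ n → sumBelow n f) (sym (*-suc q M)) ⟩
  sumBelow (q * suc M) f ∎
  where
  open ≡-Reasoning
  shift : ∀ d y → d + q * suc y ≡ q + (d + q * y)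
  shift d y = trans (cong (d +_) (*-suc q y)) (+-leftComm d q (q * y))

module _ (q : ℕ) where

  sumVec-cong : ∀ m {f g : Vec (Fin q) m → ℕ} → (∀ u → f u ≡ g u) → sumVec q m f ≡ sumVec q m g
  sumVec-cong zero    f≗g = f≗g []
  sumVec-cong (suc m) f≗g = sumFin-cong q (λ x → sumVec-cong m (λ u → f≗g (x ∷ u)))

  sumVec-mono : ∀ m {f g : Vec (Fin q) m → ℕ} → (∀ u → f u ≤ g u) → sumVec q m f ≤ sumVec q m g
  sumVec-mono zero    f≤g = f≤g []
  sumVec-mono (suc m) f≤g = sumFin-mono q (λ x → sumVec-mono m (λ u → f≤g (x ∷ u)))

  sumVec-+ : ∀ m (f g : Vec (Fin q) m → ℕ) → sumVec q m (λ u → f u + g u) ≡ sumVec q m f + sumVec q m g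
  sumVec-+ zero    f g = refl
  sumVec-+ (suc m) f g = trans (sumFin-cong q (λ x → sumVec-+ m _ _)) (sumFin-+ q _ _)

  sumVec-const : ∀ m c → sumVec q m (λ _ → c) ≡ q ^ m * c
  sumVec-const zero    c = sym (+-identityʳ c)
  sumVec-const (suc m) c = trans (sumFin-cong q (λ _ → sumVec-const m c))
                                 (trans (sumFin-const q _) (sym (*-assoc q (q ^ m) c)))

  sumVec-* : ∀ m c (f : Vec (Fin q) m → ℕ) → sumVec q m (λ u → c * f u) ≡ c * sumVec q m f
  sumVec-* zero    c f = refl
  sumVec-* (suc m) c f = trans (sumFin-cong q (λ x → sumVec-* m c _)) (sumFin-* q c _)

  sumVec-++ : ∀ a b (f : Vec (Fin q) (a + b) → ℕ) →
              sumVec q (a + b) f ≡ sumVec q a (λ u → sumVec q b (λ v → f (u ++ v)))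
  sumVec-++ zero    b f = refl
  sumVec-++ (suc a) b f = sumFin-cong q (λ x → sumVec-++ a b (λ u → f (x ∷ u)))

  sumVec-sumFin : ∀ m n (g : Vec (Fin q) m → Fin n → ℕ) →
                  sumVec q m (λ u → sumFin n (g u)) ≡ sumFin n (λ y → sumVec q m (λ u → g u y))
  sumVec-sumFin zero    n g = refl
  sumVec-sumFin (suc m) n g = trans (sumFin-cong q (λ x → sumVec-sumFin m n (λ u → g (x ∷ u))))
                                    (sumFin-comm q n _)

  sumVec-comm : ∀ a b (g : Vec (Fin q) a → Vec (Fin q) b → ℕ) →
                sumVec q a (λ u → sumVec q b (g u)) ≡ sumVec q b (λ v → sumVec q a (λ u → g u v))
  sumVec-comm a zero    g = refl
  sumVec-comm a (suc b) g = trans (sumVec-sumFin a q (λ u y → sumVec q b (λ v → g u (y ∷ v))))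
                                  (sumFin-cong q (λ y → sumVec-comm a b (λ u v → g u (y ∷ v))))

  sumVec-val : ∀ m (f : ℕ → ℕ) → sumVec q m (λ u → f (val q u)) ≡ sumBelow (q ^ m) f
  sumVec-val zero    f = sym (+-identityʳ (f 0))
  sumVec-val (suc m) f = begin
    sumFin q (λ d → sumVec q m (λ u → f (toℕ d + q * val q u)))
      ≡⟨ sumFin-cong q (λ d → sumVec-val m (λ y → f (toℕ d + q * y))) ⟩
    sumBelow q (λ d → sumBelow (q ^ m) (λ y → f (d + q * y)))
      ≡⟨ sumFin-comm q (q ^ m) _ ⟩
    sumBelow (q ^ m) (λ y → sumBelow q (λ d → f (d + q * y)))
      ≡⟨ sumBelow-digits q (q ^ m) f ⟩
    sumBelow (q * q ^ m) f ∎
    where open ≡-Reasoning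

  sumVec-positive : ∀ m (f : Vec (Fin q) m → ℕ) → 0 < sumVec q m f → Σ (Vec (Fin q) m) λ u → 0 < f u
  sumVec-positive zero    f pos = [] , pos
  sumVec-positive (suc m) f pos with sumFin-positive q _ pos
  ... | x , pos′ with sumVec-positive m _ pos′
  ...   | u , fu>0 = x ∷ u , fu>0

  sumVec-≥ : ∀ m c d (f : Vec (Fin q) m → ℕ) → (∀ u → c ≤ f u + d) → q ^ m * c ≤ sumVec q m f + q ^ m * d
  sumVec-≥ m c d f c≤ = begin
    q ^ m * c                           ≡⟨ sumVec-const m c ⟨
    sumVec q m (λ _ → c)                ≤⟨ sumVec-mono m c≤ ⟩
    sumVec q m (λ u → f u + d)          ≡⟨ sumVec-+ m f (λ _ → d) ⟩
    sumVec q m f + sumVec q m (λ _ → d) ≡⟨ cong (sumVec q m f +_) (sumVec-const m d) ⟩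
    sumVec q m f + q ^ m * d            ∎
    where open ≤-Reasoning

-- Counting with Boolean indicators

𝟙 : Bool → ℕ
𝟙 true  = 1
𝟙 false = 0

fromDoes : ∀ {a} {A : Set a} (a? : Dec A) → does a? ≡ true → A
fromDoes (yes a) _ = a

𝟙-does : ∀ {a p} {A : Set a} (P : ℕ → Set p) (a? : Dec A) → (A → P 1) → (¬ A → P 0) → P (𝟙 (does a?))
𝟙-does P (yes a)  yes-case no-case = yes-case a
𝟙-does P (no ¬a) yes-case no-case = no-case ¬a

0<𝟙⇒true : ∀ {b} → 0 < 𝟙 b → b ≡ true
0<𝟙⇒true {true} _ = refl

𝟙≤ : ∀ b {k} → (b ≡ true → 1 ≤ k) → 𝟙 b ≤ k
𝟙≤ false _        = z≤n
𝟙≤ true  true⇒1≤k = true⇒1≤k refl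

𝟙≤1 : ∀ b → 𝟙 b ≤ 1
𝟙≤1 false = z≤n
𝟙≤1 true  = ≤-refl

1≤𝟙 : ∀ {b} → b ≡ true → 1 ≤ 𝟙 b
1≤𝟙 refl = ≤-refl

∧-intro : ∀ {a b} → a ≡ true → b ≡ true → (a ∧ b) ≡ true
∧-intro refl refl = refl

∧-true : ∀ {a b} → (a ∧ b) ≡ true → a ≡ true × b ≡ true
∧-true {true} {true} refl = refl , refl

sumBelow-𝟙-atMostOne : ∀ n (p : ℕ → Bool) →
  (∀ {x y} → x < n → y < n → p x ≡ true → p y ≡ true → x ≡ y) → sumBelow n (𝟙 ∘ p) ≤ 1
sumBelow-𝟙-atMostOne zero    p unique = z≤n
sumBelow-𝟙-atMostOne (suc n) p unique rewrite sumBelow-last n (𝟙 ∘ p) with p n in pn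
... | false = ≤-trans (≤-reflexive (+-identityʳ _))
                      (sumBelow-𝟙-atMostOne n p (λ x<n y<n → unique (m<n⇒m<1+n x<n) (m<n⇒m<1+n y<n)))
... | true  = ≤-reflexive (cong (_+ 1) (sumBelow-zero n (𝟙 ∘ p) none))
  where
  none : ∀ x → x < n → 𝟙 (p x) ≡ 0
  none x x<n with p x in px
  ... | false = refl
  ... | true  = ⊥-elim (<-irrefl (unique (m<n⇒m<1+n x<n) ≤-refl px pn) x<n)

sumBelow-𝟙-injection : ∀ n m (p p′ : ℕ → Bool) (f : ℕ → ℕ) →
  (∀ {x} → x < n → p x ≡ true → f x < m × p′ (f x) ≡ true) →
  (∀ {x y} → x < n → y < n → p x ≡ true → p y ≡ true → f x ≡ f y → x ≡ y) →
  sumBelow n (𝟙 ∘ p) ≤ sumBelow m (𝟙 ∘ p′)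
sumBelow-𝟙-injection n m p p′ f maps injective = begin
  sumBelow n (𝟙 ∘ p)                                       ≤⟨ sumBelow-mono n hit ⟩
  sumBelow n (λ x → sumBelow m (λ y → 𝟙 (graph x y)))      ≡⟨ sumFin-comm n m _ ⟩
  sumBelow m (λ y → sumBelow n (λ x → 𝟙 (graph x y)))      ≤⟨ sumBelow-mono m fibre ⟩
  sumBelow m (𝟙 ∘ p′)                                      ∎
  where
  open ≤-Reasoning
  graph : ℕ → ℕ → Bool
  graph x y = p′ y ∧ (p x ∧ does (f x ≟ y))

  hit : ∀ x → x < n → 𝟙 (p x) ≤ sumBelow m (λ y → 𝟙 (graph x y))
  hit x x<n = 𝟙≤ (p x) λ px → let fx<m , p′fx = maps x<n px in
    ≤-trans (≤-reflexive (cong 𝟙 (sym (onGraph px p′fx)))) (sumBelow-term m (λ y → 𝟙 (graph x y)) fx<m)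
    where
    onGraph : p x ≡ true → p′ (f x) ≡ true → graph x (f x) ≡ true
    onGraph px p′fx = ∧-intro p′fx (∧-intro px (dec-true (f x ≟ f x) refl))

  fibre : ∀ y → y < m → sumBelow n (λ x → 𝟙 (graph x y)) ≤ 𝟙 (p′ y)
  fibre y _ with p′ y
  ... | false = ≤-reflexive (sumBelow-zero n _ (λ _ _ → refl))
  ... | true  = sumBelow-𝟙-atMostOne n (λ x → p x ∧ does (f x ≟ y)) same
    where
    same : ∀ {x x′} → x < n → x′ < n → (p x ∧ does (f x ≟ y)) ≡ true → (p x′ ∧ does (f x′ ≟ y)) ≡ true → x ≡ x′
    same x<n x′<n gx gx′ with ∧-true {p _} gx | ∧-true {p _} gx′
    ... | px , fx≡y | px′ , fx′≡y =
      injective x<n x′<n px px′ (trans (fromDoes (_ ≟ y) fx≡y) (sym (fromDoes (_ ≟ y) fx′≡y)))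

-- Modular arithmetic

2*pred[n]<n*n : ∀ n .{{_ : NonZero n}} → 2 * (n ∸ 1) < n * n
2*pred[n]<n*n (suc zero)    = z<s
2*pred[n]<n*n (suc (suc p)) =
  <-≤-trans (*-monoʳ-< 2 (n<1+n (suc p))) (*-monoˡ-≤ (suc (suc p)) {2} {suc (suc p)} (s≤s (s≤s z≤n)))

module _ (n : ℕ) .{{_ : NonZero n}} where

  %-cong-+ʳ : ∀ {m o} p → m % n ≡ o % n → (m + p) % n ≡ (o + p) % n
  %-cong-+ʳ {m} {o} p m≡o = begin
    (m + p) % n                ≡⟨ %-distribˡ-+ m p n ⟩
    (m % n + p % n) % n        ≡⟨ cong (λ t → (t + p % n) % n) m≡o ⟩
    (o % n + p % n) % n        ≡⟨ %-distribˡ-+ o p n ⟨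
    (o + p) % n                ∎
    where open ≡-Reasoning

  [m%n+o]%n≡[m+o]%n : ∀ m o → (m % n + o) % n ≡ (m + o) % n
  [m%n+o]%n≡[m+o]%n m o = %-cong-+ʳ o (m%n%n≡m%n m n)

  [m%n*o]%n≡[m*o]%n : ∀ m o → (m % n * o) % n ≡ (m * o) % n
  [m%n*o]%n≡[m*o]%n m o = begin
    (m % n * o) % n                ≡⟨ %-distribˡ-* (m % n) o n ⟩
    (m % n % n * (o % n)) % n      ≡⟨ cong (λ t → (t * (o % n)) % n) (m%n%n≡m%n m n) ⟩
    (m % n * (o % n)) % n          ≡⟨ %-distribˡ-* m o n ⟨
    (m * o) % n                    ∎
    where open ≡-Reasoning

  -- Adding p * (n ∸ 1) completes p to the multiple p * n.
  %-cancelʳ-+ : ∀ {m o} p → (m + p) % n ≡ (o + p) % n → m % n ≡ o % n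
  %-cancelʳ-+ {m} {o} p m+p≡o+p = begin
    m % n                            ≡⟨ [m+kn]%n≡m%n m p n ⟨
    (m + p * n) % n                  ≡⟨ cong (_% n) (complete m) ⟩
    (m + p + p * (n ∸ 1)) % n        ≡⟨ %-cong-+ʳ (p * (n ∸ 1)) m+p≡o+p ⟩
    (o + p + p * (n ∸ 1)) % n        ≡⟨ cong (_% n) (complete o) ⟨
    (o + p * n) % n                  ≡⟨ [m+kn]%n≡m%n o p n ⟩
    o % n                            ∎
    where
    open ≡-Reasoning
    complete : ∀ m → m + p * n ≡ m + p + p * (n ∸ 1)
    complete m = begin
      m + p * n                  ≡⟨ cong (λ t → m + p * t) (suc-pred n) ⟨
      m + p * suc (n ∸ 1)        ≡⟨ cong (m +_) (*-suc p (n ∸ 1)) ⟩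
      m + (p + p * (n ∸ 1))      ≡⟨ +-assoc m p _ ⟨
      m + p + p * (n ∸ 1)        ∎

  m<n⇒[m+kn]%n≡m : ∀ {m} k → m < n → (m + k * n) % n ≡ m
  m<n⇒[m+kn]%n≡m {m} k m<n = trans ([m+kn]%n≡m%n m k n) (m<n⇒m%n≡m m<n)

  m<n⇒[m+kn]/n≡k : ∀ {m} k → m < n → (m + k * n) / n ≡ k
  m<n⇒[m+kn]/n≡k {m} k m<n = begin
    (m + k * n) / n            ≡⟨ +-distrib-/-∣ʳ m (n∣m*n k) ⟩
    m / n + k * n / n          ≡⟨ cong₂ _+_ (m<n⇒m/n≡0 m<n) (m*n/n≡m k n) ⟩
    k                          ∎
    where open ≡-Reasoning

  [m+n*k]/n≡m/n+k : ∀ m k → (m + n * k) / n ≡ m / n + k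
  [m+n*k]/n≡m/n+k m k = trans (+-distrib-/-∣ʳ m (m∣m*n k)) (cong (m / n +_) (trans (/-congˡ (*-comm n k)) (m*n/n≡m k n)))

  +-*-injective : ∀ {m m′ k k′} → m < n → m′ < n → m + k * n ≡ m′ + k′ * n → m ≡ m′ × k ≡ k′
  +-*-injective {k = k} {k′} m<n m′<n eq =
    trans (sym (m<n⇒[m+kn]%n≡m k m<n)) (trans (cong (_% n) eq) (m<n⇒[m+kn]%n≡m k′ m′<n)) ,
    trans (sym (m<n⇒[m+kn]/n≡k k m<n)) (trans (cong (_/ n) eq) (m<n⇒[m+kn]/n≡k k′ m′<n))

  %-/-injective : ∀ {m o} → m % n ≡ o % n → m / n ≡ o / n → m ≡ o
  %-/-injective {m} {o} m%≡ m/≡ = begin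
    m                    ≡⟨ m≡m%n+[m/n]*n m n ⟩
    m % n + m / n * n    ≡⟨ cong₂ (λ r k → r + k * n) m%≡ m/≡ ⟩
    o % n + o / n * n    ≡⟨ m≡m%n+[m/n]*n o n ⟨
    o                    ∎
    where open ≡-Reasoning

m%[n*o]≡m%n+n*[m/n%o] : ∀ m n o .{{_ : NonZero n}} .{{_ : NonZero o}} .{{_ : NonZero (n * o)}} →
                         m % (n * o) ≡ m % n + n * (m / n % o)
m%[n*o]≡m%n+n*[m/n%o] m n o = let instance _ = m*n≢0 o n in begin
  m % (n * o)                             ≡⟨ m≡m%n+[m/n]*n (m % (n * o)) n ⟩
  m % (n * o) % n + m % (n * o) / n * n   ≡⟨ cong₂ _+_ (m∣n⇒o%n%m≡o%m n (n * o) m (m∣m*n o)) (*-comm _ n) ⟩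
  m % n + n * (m % (n * o) / n)           ≡⟨ cong (λ t → m % n + n * t) (trans (/-congˡ {o = n} (%-congʳ (*-comm n o)))
                                                                               (m%[n*o]/o≡m/o%n m o n)) ⟩
  m % n + n * (m / n % o)                 ∎
  where open ≡-Reasoning

-- Multipliers that are nearly zero modulo Q²

module NearZero (Q : ℕ) .{{_ : NonZero Q}} where

  M : ℕ
  M = Q * Q

  instance
    M≢0 : NonZero M
    M≢0 = m*n≢0 Q Q

  -- F * e is congruent modulo Q² to an integer in the open interval (−Q, Q).
  nearZero : ℕ → ℕ → Bool
  nearZero F e = does ((F * e + (Q ∸ 1)) % M ≤? 2 * (Q ∸ 1))

  pred[Q]<Q : Q ∸ 1 < Q
  pred[Q]<Q = ≤-reflexive (suc-pred Q)

  nearZero⁺ : ℕ → ℕ → Bool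
  nearZero⁺ F e = does (0 <? e) ∧ nearZero F e

  nearZeroCount : ℕ → ℕ
  nearZeroCount F = sumBelow Q (𝟙 ∘ nearZero⁺ F)

  multiplicity : ℕ → ℕ
  multiplicity F = 1 + (nearZeroCount F + nearZeroCount F)

  -- For a fixed e, the numbers v = F * e + (Q − 1) with nearZero F e lie in the windows
  -- [k M, k M + 2Q − 1); the code of F records the window k and the position of v in it in units of e.
  module FixedMultiplier (m e : ℕ) .{{_ : NonZero e}} (1≤m : 1 ≤ m) (e<Q : e < Q) where

    private
      T : ℕ
      T = suc (2 * (Q ∸ 1) / e)

      v : ℕ → ℕ
      v F = F * e + (Q ∸ 1)

      code : ℕ → ℕ
      code F = v F % M / e + v F / M * T

      position<T : ∀ F → nearZero F e ≡ true → v F % M / e < T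
      position<T F nz = s≤s (/-monoˡ-≤ e (fromDoes (_ ≤? _) nz))

      code< : ∀ {F} → F < M * m → nearZero F e ≡ true → code F < (m * e + 1) * T
      code< {F} F<Mm nz = begin-strict
        v F % M / e + v F / M * T    <⟨ +-monoˡ-< (v F / M * T) (position<T F nz) ⟩
        T + v F / M * T              ≤⟨ *-monoˡ-≤ T (m<n*o⇒m/o<n {n = m * e + 1} v<) ⟩
        (m * e + 1) * T              ∎
        where
        open ≤-Reasoning
        v< : v F < (m * e + 1) * M
        v< = begin-strict
          F * e + (Q ∸ 1)            <⟨ +-mono-<-≤ (*-monoˡ-< e F<Mm) (≤-trans (m∸n≤m Q 1) (m≤m*n Q Q)) ⟩
          M * m * e + M              ≡⟨ windows M m e ⟩
          (m * e + 1) * M            ∎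
          where
          windows : ∀ M m e → M * m * e + M ≡ (m * e + 1) * M
          windows = solve-∀

      code-injective : ∀ {F F′} → nearZero F e ≡ true → nearZero F′ e ≡ true → code F ≡ code F′ → F ≡ F′
      code-injective {F} {F′} nz nz′ code≡ =
        *-cancelʳ-≡ F F′ e (+-cancelʳ-≡ (Q ∸ 1) _ _ (%-/-injective M r≡r′ k≡k′))
        where
        r r′ k : ℕ
        r = v F % M
        r′ = v F′ % M
        k = v F / M
        decoded : r / e ≡ r′ / e × k ≡ v F′ / M
        decoded = +-*-injective T {k = k} {k′ = v F′ / M} (position<T F nz) (position<T F′ nz′) code≡
        position≡ : r / e ≡ r′ / e
        position≡ = proj₁ decoded
        k≡k′ : k ≡ v F′ / M
        k≡k′ = proj₂ decoded
        cross : r + F′ * e ≡ r′ + F * e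
        cross = +-cancelʳ-≡ (k * M + (Q ∸ 1)) _ _ (begin
          r + F′ * e + (k * M + (Q ∸ 1))      ≡⟨ swap r (F′ * e) (k * M) (Q ∸ 1) ⟩
          (r + k * M) + v F′                  ≡⟨ cong₂ _+_ (sym (m≡m%n+[m/n]*n (v F) M))
                                                           (trans (m≡m%n+[m/n]*n (v F′) M) (cong (λ j → r′ + j * M) (sym k≡k′))) ⟩
          v F + (r′ + k * M)                  ≡⟨ swap′ (F * e) (Q ∸ 1) r′ (k * M) ⟩
          r′ + F * e + (k * M + (Q ∸ 1))      ∎)
          where
          open ≡-Reasoning
          swap : ∀ a b c d → a + b + (c + d) ≡ (a + c) + (b + d)
          swap = solve-∀
          swap′ : ∀ a b c d → (a + b) + (c + d) ≡ c + a + (d + b)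
          swap′ = solve-∀
        r≡r′ : r ≡ r′
        r≡r′ = %-/-injective e (trans (sym ([m+kn]%n≡m%n r F′ e)) (trans (cong (_% e) cross) ([m+kn]%n≡m%n r′ F e)))
                             position≡

      codeRange≤ : (m * e + 1) * T ≤ 6 * m * Q
      codeRange≤ = begin
        (m * e + 1) * T              ≤⟨ *-monoˡ-≤ T (+-monoʳ-≤ (m * e) (*-mono-≤ 1≤m (>-nonZero⁻¹ e))) ⟩
        (m * e + m * e) * T          ≡⟨ regroup m e T ⟩
        2 * m * (e * T)              ≤⟨ *-monoʳ-≤ (2 * m) eT≤ ⟩
        2 * m * (3 * Q)              ≡⟨ regroup′ m Q ⟩
        6 * m * Q                    ∎
        where
        open ≤-Reasoning
        regroup : ∀ m e T → (m * e + m * e) * T ≡ 2 * m * (e * T)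
        regroup = solve-∀
        regroup′ : ∀ m Q → 2 * m * (3 * Q) ≡ 6 * m * Q
        regroup′ = solve-∀
        eT≤ : e * T ≤ 3 * Q
        eT≤ = begin
          e * T                                  ≡⟨ *-suc e _ ⟩
          e + e * (2 * (Q ∸ 1) / e)              ≤⟨ +-mono-≤ (<⇒≤ e<Q) (≤-trans (≤-reflexive (*-comm e _)) (m/n*n≤m _ e)) ⟩
          Q + 2 * (Q ∸ 1)                        ≤⟨ +-monoʳ-≤ Q (*-monoʳ-≤ 2 (m∸n≤m Q 1)) ⟩
          Q + 2 * Q                              ∎

    nearZero-count : sumBelow (M * m) (λ F → 𝟙 (nearZero F e)) ≤ 6 * m * Q
    nearZero-count = begin
      sumBelow (M * m) (λ F → 𝟙 (nearZero F e))
        ≤⟨ sumBelow-𝟙-injection (M * m) ((m * e + 1) * T) _ (λ _ → true) code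
             (λ F<Mm nz → code< F<Mm nz , refl) (λ _ _ → code-injective) ⟩
      sumBelow ((m * e + 1) * T) (λ _ → 1)
        ≡⟨ trans (sumFin-const ((m * e + 1) * T) 1) (*-identityʳ _) ⟩
      (m * e + 1) * T
        ≤⟨ codeRange≤ ⟩
      6 * m * Q ∎
      where open ≤-Reasoning

  nearZeroCount-sum : ∀ m → 1 ≤ m → sumBelow (M * m) nearZeroCount ≤ 6 * (M * m)
  nearZeroCount-sum m 1≤m = begin
    sumBelow (M * m) (λ F → sumBelow Q (𝟙 ∘ nearZero⁺ F))     ≡⟨ sumFin-comm (M * m) Q _ ⟩
    sumBelow Q (λ e → sumBelow (M * m) (λ F → 𝟙 (nearZero⁺ F e))) ≤⟨ sumBelow-mono Q perMultiplier ⟩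
    sumBelow Q (λ _ → 6 * m * Q)                              ≡⟨ sumFin-const Q _ ⟩
    Q * (6 * m * Q)                                           ≡⟨ regroup Q m ⟩
    6 * (M * m)                                               ∎
    where
    open ≤-Reasoning
    regroup : ∀ Q m → Q * (6 * m * Q) ≡ 6 * (Q * Q * m)
    regroup = solve-∀
    perMultiplier : ∀ e → e < Q → sumBelow (M * m) (λ F → 𝟙 (nearZero⁺ F e)) ≤ 6 * m * Q
    perMultiplier zero    _   = ≤-trans (≤-reflexive (sumBelow-zero (M * m) _ (λ _ _ → refl))) z≤n
    perMultiplier (suc e) e<Q = FixedMultiplier.nearZero-count m (suc e) 1≤m e<Q

  nearZeroCount-Q : ∀ F → F % M ≡ Q → nearZeroCount F ≡ 0
  nearZeroCount-Q F F%M≡Q = sumBelow-zero Q _ noNearZero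
    where
    noNearZero : ∀ e → e < Q → 𝟙 (nearZero⁺ F e) ≡ 0
    noNearZero zero    _   = refl
    noNearZero (suc e) e<Q = cong 𝟙 (dec-false (_ ≤? _) (<⇒≱ (begin-strict
      2 * (Q ∸ 1)                             ≡⟨ cong ((Q ∸ 1) +_) (+-identityʳ (Q ∸ 1)) ⟩
      (Q ∸ 1) + (Q ∸ 1)                       <⟨ +-monoˡ-< (Q ∸ 1) (pred[Q]<Q) ⟩
      Q + (Q ∸ 1)                             ≤⟨ +-monoˡ-≤ (Q ∸ 1) (m≤m*n Q (suc e)) ⟩
      Q * suc e + (Q ∸ 1)                     ≡⟨ m<n⇒m%n≡m Qe+s<M ⟨
      (Q * suc e + (Q ∸ 1)) % M               ≡⟨ %-cong-+ʳ M (Q ∸ 1) Fe≡Qe ⟨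
      (F * suc e + (Q ∸ 1)) % M               ∎)))
      where
      open ≤-Reasoning
      Fe≡Qe : F * suc e % M ≡ Q * suc e % M
      Fe≡Qe = trans (sym ([m%n*o]%n≡[m*o]%n M F (suc e))) (cong (λ x → x * suc e % M) F%M≡Q)
      Qe+s<M : Q * suc e + (Q ∸ 1) < M
      Qe+s<M = begin-strict
        Q * suc e + (Q ∸ 1)      <⟨ +-monoʳ-< (Q * suc e) (pred[Q]<Q) ⟩
        Q * suc e + Q            ≡⟨ trans (+-comm _ Q) (sym (*-suc Q (suc e))) ⟩
        Q * suc (suc e)          ≤⟨ *-monoʳ-≤ Q e<Q ⟩
        Q * Q                    ∎

  ≡Q-count : ∀ m → 2 ≤ Q → m ≤ sumBelow (M * m) (λ F → 𝟙 (does (F % M ≟ Q)))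
  ≡Q-count m 2≤Q = begin
    m
      ≡⟨ trans (sym (*-identityʳ m)) (sym (sumFin-const m 1)) ⟩
    sumBelow m (λ _ → 𝟙 true)
      ≤⟨ sumBelow-𝟙-injection m (M * m) (λ _ → true) (λ F → does (F % M ≟ Q)) (λ j → Q + j * M) maps injective ⟩
    sumBelow (M * m) (λ F → 𝟙 (does (F % M ≟ Q))) ∎
    where
    open ≤-Reasoning
    Q<M : Q < M
    Q<M = m<m*n Q Q 2≤Q
    maps : ∀ {j} → j < m → true ≡ true → Q + j * M < M * m × does ((Q + j * M) % M ≟ Q) ≡ true
    maps {j} j<m _ = (begin-strict
      Q + j * M       <⟨ +-monoˡ-< (j * M) Q<M ⟩
      suc j * M       ≤⟨ *-monoˡ-≤ M j<m ⟩
      m * M           ≡⟨ *-comm m M ⟩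
      M * m           ∎) , dec-true (_ ≟ Q) (m<n⇒[m+kn]%n≡m M j Q<M)
    injective : ∀ {j j′} → j < m → j′ < m → true ≡ true → true ≡ true → Q + j * M ≡ Q + j′ * M → j ≡ j′
    injective _ _ _ _ eq = proj₂ (+-*-injective M Q<M Q<M eq)

  middleBlock : ℕ → ℕ → ℕ → ℕ
  middleBlock c F x = (c + F * x) % M / Q

  -- X₀ = (c + F x) mod Q² and X = (c + F (x + e)) mod Q² lie in one block [b Q, b Q + Q), so
  -- F e + (Q − 1) is congruent modulo Q² to X + (Q − 1) − X₀, which lies in [0, 2Q − 1).
  middleBlock-collision : ∀ c F x e → middleBlock c F (x + e) ≡ middleBlock c F x → nearZero F e ≡ true
  middleBlock-collision c F x e block≡ = dec-true (_ ≤? _) (subst (_≤ 2 * (Q ∸ 1)) (sym step≡gap) gap≤)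
    where
    y X₀ X gap : ℕ
    y = c + F * x
    X₀ = y % M
    X = (y + F * e) % M
    gap = X % Q + (Q ∸ 1) ∸ X₀ % Q
    quotient≡ : X / Q ≡ X₀ / Q
    quotient≡ = trans (cong (λ z → z % M / Q) (sym (trans (cong (c +_) (*-distribˡ-+ F x e)) (sym (+-assoc c _ _)))))
                      block≡
    gap≤ : gap ≤ 2 * (Q ∸ 1)
    gap≤ = begin
      gap                          ≤⟨ m∸n≤m _ (X₀ % Q) ⟩
      X % Q + (Q ∸ 1)              ≤⟨ +-monoˡ-≤ (Q ∸ 1) (<⇒≤pred (m%n<n X Q)) ⟩
      (Q ∸ 1) + (Q ∸ 1)            ≡⟨ cong ((Q ∸ 1) +_) (+-identityʳ (Q ∸ 1)) ⟨
      2 * (Q ∸ 1)                  ∎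
      where open ≤-Reasoning
    gap<M : gap < M
    gap<M = ≤-<-trans gap≤ (2*pred[n]<n*n Q)
    gap+X₀ : gap + X₀ ≡ X + (Q ∸ 1)
    gap+X₀ = begin
      gap + X₀                                 ≡⟨ cong (gap +_) (m≡m%n+[m/n]*n X₀ Q) ⟩
      gap + (X₀ % Q + X₀ / Q * Q)              ≡⟨ +-assoc gap _ _ ⟨
      gap + X₀ % Q + X₀ / Q * Q                ≡⟨ cong (_+ X₀ / Q * Q) (m∸n+n≡m X₀%Q≤) ⟩
      X % Q + (Q ∸ 1) + X₀ / Q * Q             ≡⟨ cong (λ k → X % Q + (Q ∸ 1) + k * Q) quotient≡ ⟨
      X % Q + (Q ∸ 1) + X / Q * Q              ≡⟨ +-rightComm (X % Q) (Q ∸ 1) _ ⟩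
      X % Q + X / Q * Q + (Q ∸ 1)              ≡⟨ cong (_+ (Q ∸ 1)) (m≡m%n+[m/n]*n X Q) ⟨
      X + (Q ∸ 1)                              ∎
      where
      open ≡-Reasoning
      X₀%Q≤ : X₀ % Q ≤ X % Q + (Q ∸ 1)
      X₀%Q≤ = ≤-trans (<⇒≤pred (m%n<n X₀ Q)) (m≤n+m (Q ∸ 1) (X % Q))
    step≡gap : (F * e + (Q ∸ 1)) % M ≡ gap
    step≡gap = trans (%-cancelʳ-+ M X₀ (begin
      (F * e + (Q ∸ 1) + y % M) % M   ≡⟨ cong (_% M) (+-comm _ (y % M)) ⟩
      (y % M + (F * e + (Q ∸ 1))) % M ≡⟨ [m%n+o]%n≡[m+o]%n M y _ ⟩
      (y + (F * e + (Q ∸ 1))) % M     ≡⟨ cong (_% M) (+-assoc y _ _) ⟨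
      (y + F * e + (Q ∸ 1)) % M       ≡⟨ [m%n+o]%n≡[m+o]%n M (y + F * e) _ ⟨
      (X + (Q ∸ 1)) % M               ≡⟨ cong (_% M) gap+X₀ ⟨
      (gap + X₀) % M                  ∎)) (m<n⇒m%n≡m gap<M)
      where open ≡-Reasoning

  -- A collision D x = D x₀ with x ≠ x₀ makes |x − x₀| a nonzero e with nearZero F e.
  middleBlock-fibre : ∀ c F {x₀} → x₀ < Q →
    sumBelow Q (λ x → 𝟙 (does (middleBlock c F x ≟ middleBlock c F x₀))) ≤ multiplicity F
  middleBlock-fibre c F {x₀} x₀<Q = begin
    sumBelow Q (λ x → 𝟙 (does (D x ≟ D x₀)))
      ≤⟨ sumBelow-mono Q (λ x _ → split x) ⟩
    sumBelow Q (λ x → 𝟙 (does (x ≟ x₀)) + (𝟙 (above x) + 𝟙 (below x)))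
      ≡⟨ trans (sumFin-+ Q _ _) (cong (sumBelow Q (λ x → 𝟙 (does (x ≟ x₀))) +_) (sumFin-+ Q _ _)) ⟩
    sumBelow Q (λ x → 𝟙 (does (x ≟ x₀))) + (sumBelow Q (𝟙 ∘ above) + sumBelow Q (𝟙 ∘ below))
      ≤⟨ +-mono-≤ (sumBelow-𝟙-atMostOne Q _ λ _ _ x≡x₀ y≡x₀ →
                     trans (fromDoes (_ ≟ x₀) x≡x₀) (sym (fromDoes (_ ≟ x₀) y≡x₀)))
                  (+-mono-≤ aboveCount belowCount) ⟩
    multiplicity F ∎
    where
    open ≤-Reasoning
    D : ℕ → ℕ
    D = middleBlock c F
    above below : ℕ → Bool
    above x = does (x₀ <? x) ∧ nearZero⁺ F (x ∸ x₀)
    below x = does (x <? x₀) ∧ nearZero⁺ F (x₀ ∸ x)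

    collision⁺ : ∀ {x x′} → x < x′ → D x′ ≡ D x → nearZero⁺ F (x′ ∸ x) ≡ true
    collision⁺ {x} x<x′ D≡ = ∧-intro (dec-true (0 <? _) (m<n⇒0<n∸m x<x′))
      (middleBlock-collision c F x _ (trans (cong D (m+[n∸m]≡n (<⇒≤ x<x′))) D≡))

    split : ∀ x → 𝟙 (does (D x ≟ D x₀)) ≤ 𝟙 (does (x ≟ x₀)) + (𝟙 (above x) + 𝟙 (below x))
    split x with <-cmp x x₀
    ... | tri≈ _ refl _ =
      ≤-trans (𝟙≤1 (does (D x ≟ D x)))
              (≤-trans (1≤𝟙 (dec-true (x ≟ x) refl)) (m≤m+n (𝟙 (does (x ≟ x))) (𝟙 (above x) + 𝟙 (below x))))
    ... | tri< x<x₀ _ _ = 𝟙≤ _ λ D≡ →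
      ≤-trans (1≤𝟙 (∧-intro (dec-true (x <? x₀) x<x₀) (collision⁺ x<x₀ (sym (fromDoes (_ ≟ _) D≡)))))
              (≤-trans (m≤n+m (𝟙 (below x)) (𝟙 (above x))) (m≤n+m _ (𝟙 (does (x ≟ x₀)))))
    ... | tri> _ _ x₀<x = 𝟙≤ _ λ D≡ →
      ≤-trans (1≤𝟙 (∧-intro (dec-true (x₀ <? x) x₀<x) (collision⁺ x₀<x (fromDoes (_ ≟ _) D≡))))
              (≤-trans (m≤m+n (𝟙 (above x)) (𝟙 (below x))) (m≤n+m _ (𝟙 (does (x ≟ x₀)))))

    aboveCount : sumBelow Q (𝟙 ∘ above) ≤ nearZeroCount F
    aboveCount = sumBelow-𝟙-injection Q Q above (nearZero⁺ F) (_∸ x₀)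
      (λ {x} x<Q ab → ≤-<-trans (m∸n≤m x x₀) x<Q , proj₂ (∧-true {does (x₀ <? x)} ab))
      (λ {x} {x′} _ _ ab ab′ → ∸-cancelʳ-≡ (<⇒≤ (fromDoes (x₀ <? x) (proj₁ (∧-true {does (x₀ <? x)} ab))))
                                             (<⇒≤ (fromDoes (x₀ <? x′) (proj₁ (∧-true {does (x₀ <? x′)} ab′)))))

    belowCount : sumBelow Q (𝟙 ∘ below) ≤ nearZeroCount F
    belowCount = sumBelow-𝟙-injection Q Q below (nearZero⁺ F) (x₀ ∸_)
      (λ {x} _ bl → ≤-<-trans (m∸n≤m x₀ x) x₀<Q , proj₂ (∧-true {does (x <? x₀)} bl))
      (λ {x} {x′} _ _ bl bl′ → ∸-cancelˡ-≡ (<⇒≤ (fromDoes (x <? x₀) (proj₁ (∧-true {does (x <? x₀)} bl))))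
                                             (<⇒≤ (fromDoes (x′ <? x₀) (proj₁ (∧-true {does (x′ <? x₀)} bl′)))))

-- Blocks of base-q digits

val-++ : ∀ q {a b} (xs : Vec (Fin q) a) (ys : Vec (Fin q) b) → val q (xs ++ ys) ≡ val q xs + q ^ a * val q ys
val-++ q []               ys = sym (+-identityʳ (val q ys))
val-++ q {suc a} (x ∷ xs) ys = trans (cong (λ v → toℕ x + q * v) (val-++ q xs ys)) (expand (toℕ x) q (val q xs) (q ^ a) (val q ys))
  where
  expand : ∀ d q v Q w → d + q * (v + Q * w) ≡ d + q * v + q * Q * w
  expand = solve-∀

val< : ∀ q {m} (xs : Vec (Fin q) m) → val q xs < q ^ m
val< q []               = z<s
val< q {suc m} (x ∷ xs) = begin-strict
  toℕ x + q * val q xs    <⟨ +-monoˡ-< (q * val q xs) (toℕ<n x) ⟩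
  q + q * val q xs        ≡⟨ *-suc q (val q xs) ⟨
  q * suc (val q xs)      ≤⟨ *-monoʳ-≤ q (val< q xs) ⟩
  q * q ^ m               ∎
  where open ≤-Reasoning

module _ (q : ℕ) (2≤q : 2 ≤ q) where

  private instance
    q≢0 : NonZero q
    q≢0 = >-nonZero (≤-trans (s≤s z≤n) 2≤q)

  digitBlock : ℕ → ℕ → ℕ → ℕ
  digitBlock p h N = _%_ (_/_ N (q ^ p) {{m^n≢0 q p}}) (q ^ h) {{m^n≢0 q h}}

  digitBlock-suc : ∀ p h N → digitBlock p (suc h) N ≡ digit q 2≤q p N + q * digitBlock (suc p) h N
  digitBlock-suc p h N = begin
    N / q ^ p % (q * q ^ h)                        ≡⟨ m%[n*o]≡m%n+n*[m/n%o] (N / q ^ p) q (q ^ h) ⟩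
    N / q ^ p % q + q * (N / q ^ p / q % q ^ h)    ≡⟨ cong (λ M → N / q ^ p % q + q * (M % q ^ h)) shift ⟩
    digit q 2≤q p N + q * digitBlock (suc p) h N   ∎
    where
    open ≡-Reasoning
    instance
      _ = m^n≢0 q p
      _ = m^n≢0 q h
      _ = m*n≢0 (q ^ p) q
      _ = m^n≢0 q (suc h)
      _ = m^n≢0 q (suc p)
    shift : N / q ^ p / q ≡ N / q ^ suc p
    shift = trans (m/n/o≡m/[n*o] N (q ^ p) q) (/-congʳ (*-comm (q ^ p) q))

  digits⇒digitBlock : ∀ h p N N′ → (∀ s → s < h → digit q 2≤q (p + s) N ≡ digit q 2≤q (p + s) N′) →
                      digitBlock p h N ≡ digitBlock p h N′
  digits⇒digitBlock zero    p N N′ _      = trans (n%1≡0 (N / q ^ p)) (sym (n%1≡0 (N′ / q ^ p)))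
    where instance _ = m^n≢0 q p
  digits⇒digitBlock (suc h) p N N′ digit≡ = begin
    digitBlock p (suc h) N                              ≡⟨ digitBlock-suc p h N ⟩
    digit q 2≤q p N + q * digitBlock (suc p) h N        ≡⟨ cong₂ (λ d r → d + q * r) lowest rest ⟩
    digit q 2≤q p N′ + q * digitBlock (suc p) h N′      ≡⟨ digitBlock-suc p h N′ ⟨
    digitBlock p (suc h) N′                             ∎
    where
    open ≡-Reasoning
    lowest : digit q 2≤q p N ≡ digit q 2≤q p N′
    lowest = subst (λ t → digit q 2≤q t N ≡ digit q 2≤q t N′) (+-identityʳ p) (digit≡ 0 z<s)
    rest : digitBlock (suc p) h N ≡ digitBlock (suc p) h N′
    rest = digits⇒digitBlock h (suc p) N N′
             (λ s s<h → subst (λ t → digit q 2≤q t N ≡ digit q 2≤q t N′) (+-suc p s) (digit≡ (suc s) (s≤s s<h)))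

  module Window (t₀ h : ℕ) where

    private instance
      q^t₀≢0 : NonZero (q ^ t₀)
      q^t₀≢0 = m^n≢0 q t₀
      q^h≢0 : NonZero (q ^ h)
      q^h≢0 = m^n≢0 q h

    open NearZero (q ^ h) {{q^h≢0}} public

    carry : ℕ → ℕ → ℕ
    carry F vP = F * vP / q ^ t₀

    digitBlock-window : ∀ F vP x vR →
      digitBlock (t₀ + h) h (F * (vP + q ^ t₀ * (x + q ^ h * vR))) ≡ ((F * vP / q ^ t₀ + F * x) / q ^ h + F * vR) % q ^ h
    digitBlock-window F vP x vR = cong (_% q ^ h) (begin
      F * (vP + q ^ t₀ * (x + q ^ h * vR)) / q ^ (t₀ + h)      ≡⟨ /-congʳ (^-distribˡ-+-* q t₀ h) ⟩
      F * (vP + q ^ t₀ * (x + q ^ h * vR)) / (q ^ t₀ * q ^ h)  ≡⟨ m/n/o≡m/[n*o] _ (q ^ t₀) (q ^ h) ⟨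
      F * (vP + q ^ t₀ * (x + q ^ h * vR)) / q ^ t₀ / q ^ h    ≡⟨ cong (λ y → y / q ^ t₀ / q ^ h) (expand F vP (q ^ t₀) x (q ^ h) vR) ⟩
      (F * vP + q ^ t₀ * (F * x + q ^ h * (F * vR))) / q ^ t₀ / q ^ h ≡⟨ cong (_/ q ^ h) ([m+n*k]/n≡m/n+k (q ^ t₀) (F * vP) _) ⟩
      (F * vP / q ^ t₀ + (F * x + q ^ h * (F * vR))) / q ^ h  ≡⟨ cong (_/ q ^ h) (+-assoc (F * vP / q ^ t₀) _ _) ⟨
      (F * vP / q ^ t₀ + F * x + q ^ h * (F * vR)) / q ^ h    ≡⟨ [m+n*k]/n≡m/n+k (q ^ h) (F * vP / q ^ t₀ + F * x) (F * vR) ⟩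
      (F * vP / q ^ t₀ + F * x) / q ^ h + F * vR              ∎)
      where
      open ≡-Reasoning
      instance
        _ = m^n≢0 q (t₀ + h)
        _ = m*n≢0 (q ^ t₀) (q ^ h)
      expand : ∀ F vP T x Q vR → F * (vP + T * (x + Q * vR)) ≡ F * vP + T * (F * x + Q * (F * vR))
      expand = solve-∀

    digits⇒middleBlock : ∀ F vP vR x x′ →
      (∀ s → s < h → digit q 2≤q (t₀ + h + s) (F * (vP + q ^ t₀ * (x + q ^ h * vR)))
                   ≡ digit q 2≤q (t₀ + h + s) (F * (vP + q ^ t₀ * (x′ + q ^ h * vR)))) →
      middleBlock (carry F vP) F x ≡ middleBlock (carry F vP) F x′
    digits⇒middleBlock F vP vR x x′ digit≡ = begin
      Z x % (q ^ h * q ^ h) / q ^ h     ≡⟨ m%[n*o]/o≡m/o%n (Z x) (q ^ h) (q ^ h) ⟩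
      Z x / q ^ h % q ^ h               ≡⟨ %-cancelʳ-+ (q ^ h) (F * vR) block≡ ⟩
      Z x′ / q ^ h % q ^ h              ≡⟨ m%[n*o]/o≡m/o%n (Z x′) (q ^ h) (q ^ h) ⟨
      Z x′ % (q ^ h * q ^ h) / q ^ h    ∎
      where
      open ≡-Reasoning
      Z : ℕ → ℕ
      Z y = F * vP / q ^ t₀ + F * y
      block≡ : (Z x / q ^ h + F * vR) % q ^ h ≡ (Z x′ / q ^ h + F * vR) % q ^ h
      block≡ = trans (sym (digitBlock-window F vP x vR))
                     (trans (digits⇒digitBlock h (t₀ + h) _ _ digit≡) (digitBlock-window F vP x′ vR))

-- Runs of cell-probe programs

module _ (w : ℕ) where

  ⌊≟⌋-refl : ∀ (c : Word w) → ⌊ c Fin.≟ c ⌋ ≡ true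
  ⌊≟⌋-refl c = trans (isYes≗does (c Fin.≟ c)) (dec-true (c Fin.≟ c) refl)

  ⌊≟⌋-sound : ∀ {c a : Word w} → ⌊ c Fin.≟ a ⌋ ≡ true → c ≡ a
  ⌊≟⌋-sound {c} {a} c≟a = fromDoes (c Fin.≟ a) (trans (sym (isYes≗does (c Fin.≟ a))) c≟a)

  memb-++ : ∀ c (xs ys : List (Word w)) → memb w c (xs ++ₗ ys) ≡ (memb w c xs ∨ memb w c ys)
  memb-++ c []       ys = refl
  memb-++ c (x ∷ xs) ys = trans (cong (⌊ c Fin.≟ x ⌋ ∨_) (memb-++ c xs ys)) (sym (∨-assoc (⌊ c Fin.≟ x ⌋) _ _))

  memb-++ˡ : ∀ {c} xs ys → memb w c xs ≡ true → memb w c (xs ++ₗ ys) ≡ true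
  memb-++ˡ {c} xs ys c∈ = trans (memb-++ c xs ys) (cong (_∨ memb w c ys) c∈)

  memb-++ʳ : ∀ {c} xs ys → memb w c ys ≡ true → memb w c (xs ++ₗ ys) ≡ true
  memb-++ʳ {c} xs ys c∈ = trans (memb-++ c xs ys) (trans (cong (memb w c xs ∨_) c∈) (∨-zeroʳ _))

  memb-here : ∀ c (xs : List (Word w)) → memb w c (c ∷ xs) ≡ true
  memb-here c xs = cong (_∨ memb w c xs) (⌊≟⌋-refl c)

  memb-there : ∀ {c} a (xs : List (Word w)) → memb w c xs ≡ true → memb w c (a ∷ xs) ≡ true
  memb-there {c} a xs c∈ = trans (cong (⌊ c Fin.≟ a ⌋ ∨_) c∈) (∨-zeroʳ _)

  memb-∷ : ∀ c a (xs : List (Word w)) → memb w c (a ∷ xs) ≡ true → memb w c xs ≡ true ⊎ (c ≡ a × memb w c xs ≡ false)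
  memb-∷ c a xs c∈ with memb w c xs in c∈xs
  ... | true  = inj₁ refl
  ... | false = inj₂ (⌊≟⌋-sound (trans (sym (∨-identityʳ _)) c∈) , refl)

  update-other : ∀ (M : Memory w) a v {c} → ⌊ c Fin.≟ a ⌋ ≡ false → update w M a v c ≡ M c
  update-other M a v {c} c≢a = cong (λ b → if b then v else M c) c≢a

  update-same : ∀ (M : Memory w) a v → update w M a v a ≡ v
  update-same M a v = cong (λ b → if b then v else M a) (⌊≟⌋-refl a)

  AgreeOn : List (Word w) → List (Word w) → Memory w → Memory w → Set
  AgreeOn xs xs′ M M′ = ∀ c → memb w c xs ≡ true → memb w c xs′ ≡ true → M c ≡ M′ c

module _ {w : ℕ} {O : Set} where

  output : Prog w O → Memory w → O
  output p M = proj₁ (run w p M)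

  final : Prog w O → Memory w → Memory w
  final p M = proj₁ (proj₂ (run w p M))

  probes : Prog w O → Memory w → List (Word w)
  probes p M = proj₂ (proj₂ (run w p M))

  final-unprobed : ∀ p M c → memb w c (probes p M) ≡ false → final p M c ≡ M c
  final-unprobed (ret o)       M c c∉ = refl
  final-unprobed (read a k)    M c c∉ = final-unprobed (k (M a)) M c (∨-conicalʳ _ _ c∉)
  final-unprobed (write a v p) M c c∉ =
    trans (final-unprobed p (update w M a v) c (∨-conicalʳ _ _ c∉)) (update-other w M a v (∨-conicalˡ _ _ c∉))

  SameRun : Prog w O → Memory w → Memory w → Set
  SameRun p M M′ = output p M ≡ output p M′ × probes p M ≡ probes p M′
                 × (∀ c → memb w c (probes p M) ≡ true → final p M c ≡ final p M′ c)

  read-sameRun : ∀ a k M M′ → M a ≡ M′ a → SameRun (k (M a)) M M′ → SameRun (read a k) M M′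
  read-sameRun a k M M′ Ma≡ (out≡ , probes≡ , final≡) =
    trans out≡ (cong (λ x → output (k x) M′) Ma≡) , cong (a ∷_) probes≡′ , final≡′
    where
    probes≡′ : probes (k (M a)) M ≡ probes (k (M′ a)) M′
    probes≡′ = trans probes≡ (cong (λ x → probes (k x) M′) Ma≡)
    final≡′ : ∀ c → memb w c (a ∷ probes (k (M a)) M) ≡ true → final (k (M a)) M c ≡ final (k (M′ a)) M′ c
    final≡′ c c∈ with memb-∷ w c a (probes (k (M a)) M) c∈
    ... | inj₁ c∈p          = trans (final≡ c c∈p) (cong (λ x → final (k x) M′ c) Ma≡)
    ... | inj₂ (refl , c∉p) = trans (final-unprobed (k (M c)) M c c∉p)
                                (trans Ma≡ (sym (final-unprobed (k (M′ c)) M′ c (trans (cong (memb w c) (sym probes≡′)) c∉p))))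

  write-sameRun : ∀ a v p M M′ → SameRun p (update w M a v) (update w M′ a v) → SameRun (write a v p) M M′
  write-sameRun a v p M M′ (out≡ , probes≡ , final≡) = out≡ , cong (a ∷_) probes≡ , final≡′
    where
    final≡′ : ∀ c → memb w c (a ∷ probes p (update w M a v)) ≡ true → final p (update w M a v) c ≡ final p (update w M′ a v) c
    final≡′ c c∈ with memb-∷ w c a (probes p (update w M a v)) c∈
    ... | inj₁ c∈p          = final≡ c c∈p
    ... | inj₂ (refl , c∉p) = trans (final-unprobed p _ c c∉p)
                                (trans (update-same w M c v)
                                (trans (sym (update-same w M′ c v))
                                       (sym (final-unprobed p _ c (trans (cong (memb w c) (sym probes≡)) c∉p)))))

  -- Agreement on the cells probed by both runs suffices: by induction, both runs probe the same
  -- addresses in the same order and read the same contents.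
  run-agree : ∀ p M M′ → AgreeOn w (probes p M) (probes p M′) M M′ → SameRun p M M′
  run-agree (ret o)       M M′ _     = refl , refl , λ _ ()
  run-agree (read a k)    M M′ agree = read-sameRun a k M M′ Ma≡ (run-agree (k (M a)) M M′ λ c c∈ c∈′ →
    agree c (memb-there w a (probes (k (M a)) M) c∈)
            (memb-there w a (probes (k (M′ a)) M′) (subst (λ x → memb w c (probes (k x) M′) ≡ true) Ma≡ c∈′)))
    where
    Ma≡ : M a ≡ M′ a
    Ma≡ = agree a (memb-here w a (probes (k (M a)) M)) (memb-here w a (probes (k (M′ a)) M′))
  run-agree (write a v p) M M′ agree = write-sameRun a v p M M′ (run-agree p _ _ agree′)
    where
    agree′ : AgreeOn w (probes p (update w M a v)) (probes p (update w M′ a v)) (update w M a v) (update w M′ a v)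
    agree′ c c∈ c∈′ with ⌊ c Fin.≟ a ⌋
    ... | true  = refl
    ... | false = agree c (memb-there w a (probes p (update w M a v)) c∈) (memb-there w a (probes p (update w M′ a v)) c∈′)

allProbes : ∀ {q} w {m} → Vec (Fin q × List (Word w)) m → List (Word w)
allProbes w []              = []
allProbes w ((_ , ps) ∷ xs) = ps ++ₗ allProbes w xs

module _ {q w : ℕ} (A : Alg q w) where

  memAfter : ∀ {m} → ℕ → Memory w → Vec (Fin q) m → Memory w
  memAfter t M []       = M
  memAfter t M (d ∷ ds) = memAfter (suc t) (final (step A t d) M) ds

  go-++ : ∀ {m n} t M (xs : Vec (Fin q) m) (ys : Vec (Fin q) n) →
          go A t M (xs ++ ys) ≡ go A t M xs ++ go A (t + m) (memAfter t M xs) ys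
  go-++ t M []       ys = cong (λ s → go A s M ys) (sym (+-identityʳ t))
  go-++ {suc m} t M (d ∷ xs) ys =
    cong (_ ∷_) (trans (go-++ (suc t) (final (step A t d) M) xs ys)
                       (cong (λ s → go A (suc t) (final (step A t d) M) xs ++ go A s (memAfter t M (d ∷ xs)) ys) (sym (+-suc t m))))

  memAfter-unprobed : ∀ {m} t M (xs : Vec (Fin q) m) c →
                      memb w c (allProbes w (go A t M xs)) ≡ false → memAfter t M xs c ≡ M c
  memAfter-unprobed t M []       c _  = refl
  memAfter-unprobed t M (d ∷ ds) c c∉ =
    trans (memAfter-unprobed (suc t) _ ds c (∨-conicalʳ _ _ c∉′))
          (final-unprobed (step A t d) M c (∨-conicalˡ _ _ c∉′))
    where
    c∉′ : (memb w c (probes (step A t d) M) ∨ memb w c (allProbes w (go A (suc t) (final (step A t d) M) ds))) ≡ false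
    c∉′ = trans (sym (memb-++ w c (probes (step A t d) M) _)) c∉

  go-agree : ∀ {m} t M M′ (xs : Vec (Fin q) m) →
             AgreeOn w (allProbes w (go A t M xs)) (allProbes w (go A t M′ xs)) M M′ → go A t M xs ≡ go A t M′ xs
  go-agree t M M′ []       _     = refl
  go-agree t M M′ (d ∷ ds) agree = cong₂ _∷_ (cong₂ _,_ out≡ probes≡) (go-agree (suc t) _ _ ds agree′)
    where
    p : Prog w (Fin q)
    p = step A t d
    rest : Memory w → List (Word w)
    rest M = allProbes w (go A (suc t) (final p M) ds)
    same : SameRun p M M′
    same = run-agree p M M′ λ c c∈ c∈′ →
      agree c (memb-++ˡ w (probes p M) (rest M) c∈) (memb-++ˡ w (probes p M′) (rest M′) c∈′)
    out≡ : output p M ≡ output p M′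
    out≡ = proj₁ same
    probes≡ : probes p M ≡ probes p M′
    probes≡ = proj₁ (proj₂ same)
    agree′ : AgreeOn w (rest M) (rest M′) (final p M) (final p M′)
    agree′ c c∈ c∈′ with memb w c (probes p M) in c∈p
    ... | true  = proj₂ (proj₂ same) c c∈p
    ... | false = trans (final-unprobed p M c c∈p)
                  (trans (agree c (memb-++ʳ w (probes p M) (rest M) c∈) (memb-++ʳ w (probes p M′) (rest M′) c∈′))
                         (sym (final-unprobed p M′ c (trans (cong (memb w c) (sym probes≡)) c∈p))))

≤ᵇ-true : ∀ {m n} → m ≤ n → (m ≤ᵇ n) ≡ true
≤ᵇ-true {m} {n} m≤n = dec-true (m ≤? n) m≤n

≤ᵇ-false : ∀ {m n} → n < m → (m ≤ᵇ n) ≡ false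
≤ᵇ-false {m} {n} n<m = dec-false (m ≤? n) (<⇒≱ n<m)

module _ {q : ℕ} (w : ℕ) where

  probesIn-++ : ∀ {m n} a b t (xs : Vec (Fin q × List (Word w)) m) (ys : Vec (Fin q × List (Word w)) n) →
                probesIn w a b t (xs ++ ys) ≡ probesIn w a b t xs ++ₗ probesIn w a b (t + m) ys
  probesIn-++ a b t [] ys = cong (λ s → probesIn w a b s ys) (sym (+-identityʳ t))
  probesIn-++ {suc m} a b t ((o , ps) ∷ xs) ys = begin
    window t ps ++ₗ probesIn w a b (suc t) (xs ++ ys)
      ≡⟨ cong (window t ps ++ₗ_) (probesIn-++ a b (suc t) xs ys) ⟩
    window t ps ++ₗ (probesIn w a b (suc t) xs ++ₗ probesIn w a b (suc t + m) ys)
      ≡⟨ ++-assoc (window t ps) _ _ ⟨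
    (window t ps ++ₗ probesIn w a b (suc t) xs) ++ₗ probesIn w a b (suc t + m) ys
      ≡⟨ cong (λ s → (window t ps ++ₗ probesIn w a b (suc t) xs) ++ₗ probesIn w a b s ys) (sym (+-suc t m)) ⟩
    (window t ps ++ₗ probesIn w a b (suc t) xs) ++ₗ probesIn w a b (t + suc m) ys ∎
    where
    open ≡-Reasoning
    window : ℕ → List (Word w) → List (Word w)
    window t ps = if (a ≤ᵇ t) ∧ (t ≤ᵇ b) then ps else []

  probesIn-inside : ∀ {m} a b t (xs : Vec (Fin q × List (Word w)) m) → a ≤ t → t + m ≤ suc b →
                    probesIn w a b t xs ≡ allProbes w xs
  probesIn-inside a b t [] _ _ = refl
  probesIn-inside {suc m} a b t ((o , ps) ∷ xs) a≤t t+m≤b+1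
    rewrite ≤ᵇ-true a≤t | ≤ᵇ-true (≤-pred (≤-trans (s≤s (m≤m+n t m)) (≤-trans (≤-reflexive (sym (+-suc t m))) t+m≤b+1))) =
    cong (ps ++ₗ_) (probesIn-inside a b (suc t) xs (m≤n⇒m≤1+n a≤t) (≤-trans (≤-reflexive (sym (+-suc t m))) t+m≤b+1))

  probesIn-before : ∀ {m} a b t (xs : Vec (Fin q × List (Word w)) m) → t + m ≤ a → probesIn w a b t xs ≡ []
  probesIn-before a b t [] _ = refl
  probesIn-before {suc m} a b t ((o , ps) ∷ xs) t+m≤a
    rewrite ≤ᵇ-false (≤-trans (s≤s (m≤m+n t m)) (≤-trans (≤-reflexive (sym (+-suc t m))) t+m≤a)) =
    probesIn-before a b (suc t) xs (≤-trans (≤-reflexive (sym (+-suc t m))) t+m≤a)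

  probesIn-after : ∀ {m} a b t (xs : Vec (Fin q × List (Word w)) m) → b < t → probesIn w a b t xs ≡ []
  probesIn-after a b t [] _ = refl
  probesIn-after {suc m} a b t ((o , ps) ∷ xs) b<t rewrite ≤ᵇ-false b<t | ∧-zeroʳ (a ≤ᵇ t) =
    probesIn-after a b (suc t) xs (m<n⇒m<1+n b<t)

  probesIn-block : ∀ {m n o} a b t (xs : Vec (Fin q × List (Word w)) m) (ys : Vec (Fin q × List (Word w)) n)
                   (zs : Vec (Fin q × List (Word w)) o) → t + m ≡ a → a + n ≡ suc b →
                   probesIn w a b t (xs ++ (ys ++ zs)) ≡ allProbes w ys
  probesIn-block {m} {n} a b t xs ys zs refl a+n≡ = begin
    probesIn w a b t (xs ++ (ys ++ zs))
      ≡⟨ probesIn-++ a b t xs (ys ++ zs) ⟩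
    probesIn w a b t xs ++ₗ probesIn w a b a (ys ++ zs)
      ≡⟨ cong₂ _++ₗ_ (probesIn-before a b t xs ≤-refl) (probesIn-++ a b a ys zs) ⟩
    probesIn w a b a ys ++ₗ probesIn w a b (a + n) zs
      ≡⟨ cong₂ _++ₗ_ (probesIn-inside a b a ys ≤-refl (≤-reflexive a+n≡)) (probesIn-after a b (a + n) zs (≤-reflexive (sym a+n≡))) ⟩
    allProbes w ys ++ₗ []
      ≡⟨ ++-identityʳ (allProbes w ys) ⟩
    allProbes w ys ∎
    where open ≡-Reasoning

-- Sums over sparse vectors

justs : ∀ {V m} → Vec (Maybe (Fin V)) m → ℕ
justs []             = 0
justs (nothing ∷ v) = justs v
justs (just _ ∷ v)  = suc (justs v)

-- The sum of g over the vectors with at most k entries of the form just _.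
sumSparse : (V m k : ℕ) → (Vec (Maybe (Fin V)) m → ℕ) → ℕ
sumSparse V zero    k       g = g []
sumSparse V (suc m) zero    g = sumSparse V m zero (λ v → g (nothing ∷ v))
sumSparse V (suc m) (suc k) g = sumSparse V m (suc k) (λ v → g (nothing ∷ v))
                              + sumFin V (λ a → sumSparse V m k (λ v → g (just a ∷ v)))

sumSparse-term : ∀ V m k (g : Vec (Maybe (Fin V)) m → ℕ) v → justs v ≤ k → g v ≤ sumSparse V m k g
sumSparse-term V zero    k       g []            _         = ≤-refl
sumSparse-term V (suc m) zero    g (nothing ∷ v) v≤k       = sumSparse-term V m zero _ v v≤k
sumSparse-term V (suc m) (suc k) g (nothing ∷ v) v≤k       = ≤-trans (sumSparse-term V m (suc k) _ v v≤k) (m≤m+n _ _)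
sumSparse-term V (suc m) (suc k) g (just a ∷ v)  (s≤s v≤k) =
  ≤-trans (sumSparse-term V m k _ v v≤k)
          (≤-trans (sumFin-term V (λ a → sumSparse V m k (λ v → g (just a ∷ v))) a) (m≤n+m _ _))

sumSparse-mono : ∀ V m k {g g′ : Vec (Maybe (Fin V)) m → ℕ} → (∀ v → g v ≤ g′ v) → sumSparse V m k g ≤ sumSparse V m k g′
sumSparse-mono V zero    k       g≤g′ = g≤g′ []
sumSparse-mono V (suc m) zero    g≤g′ = sumSparse-mono V m zero (λ v → g≤g′ (nothing ∷ v))
sumSparse-mono V (suc m) (suc k) g≤g′ =
  +-mono-≤ (sumSparse-mono V m (suc k) (λ v → g≤g′ (nothing ∷ v)))
           (sumFin-mono V (λ a → sumSparse-mono V m k (λ v → g≤g′ (just a ∷ v))))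

sumSparse-*ʳ : ∀ V m k (g : Vec (Maybe (Fin V)) m → ℕ) c → sumSparse V m k (λ v → g v * c) ≡ sumSparse V m k g * c
sumSparse-*ʳ V zero    k       g c = refl
sumSparse-*ʳ V (suc m) zero    g c = sumSparse-*ʳ V m zero _ c
sumSparse-*ʳ V (suc m) (suc k) g c = begin
  sumSparse V m (suc k) (λ v → g (nothing ∷ v) * c) + sumFin V (λ a → sumSparse V m k (λ v → g (just a ∷ v) * c))
    ≡⟨ cong₂ _+_ (sumSparse-*ʳ V m (suc k) _ c) (sumFin-cong V (λ a → trans (sumSparse-*ʳ V m k _ c) (*-comm _ c))) ⟩
  sumSparse V m (suc k) (λ v → g (nothing ∷ v)) * c + sumFin V (λ a → c * sumSparse V m k (λ v → g (just a ∷ v)))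
    ≡⟨ cong (sumSparse V m (suc k) _ * c +_) (trans (sumFin-* V c _) (*-comm c _)) ⟩
  sumSparse V m (suc k) (λ v → g (nothing ∷ v)) * c + sumFin V (λ a → sumSparse V m k (λ v → g (just a ∷ v))) * c
    ≡⟨ *-distribʳ-+ c (sumSparse V m (suc k) (λ v → g (nothing ∷ v)))
                      (sumFin V (λ a → sumSparse V m k (λ v → g (just a ∷ v)))) ⟨
  sumSparse V (suc m) (suc k) g * c ∎
  where open ≡-Reasoning

sumVec-sumSparse : ∀ q n V m k (g : Vec (Fin q) n → Vec (Maybe (Fin V)) m → ℕ) →
  sumVec q n (λ u → sumSparse V m k (g u)) ≡ sumSparse V m k (λ v → sumVec q n (λ u → g u v))
sumVec-sumSparse q n V zero    k       g = refl
sumVec-sumSparse q n V (suc m) zero    g = sumVec-sumSparse q n V m zero _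
sumVec-sumSparse q n V (suc m) (suc k) g =
  trans (sumVec-+ q n _ _)
        (cong₂ _+_ (sumVec-sumSparse q n V m (suc k) _)
                   (trans (sumVec-sumFin q n V _) (sumFin-cong V (λ a → sumVec-sumSparse q n V m k _))))

sparseCount : ℕ → ℕ → ℕ → ℕ
sparseCount V m k = sumSparse V m k (λ _ → 1)

sparseCount-zero : ∀ V m → sparseCount V m 0 ≡ 1
sparseCount-zero V zero    = refl
sparseCount-zero V (suc m) = sparseCount-zero V m

-- Choose, for each of at most k entries, one of the m + 1 positions (or none) and one of V values.
sparseCount≤ : ∀ V m k → 1 ≤ V → sparseCount V m k ≤ ((m + 1) * V) ^ k
sparseCount≤ V zero    k       1≤V =
  ≤-trans (≤-reflexive (sym (^-zeroˡ k))) (^-monoˡ-≤ k (≤-trans 1≤V (≤-reflexive (sym (*-identityˡ V)))))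
sparseCount≤ V (suc m) zero    1≤V = sparseCount≤ V m zero 1≤V
sparseCount≤ V (suc m) (suc k) 1≤V = begin
  sparseCount V m (suc k) + sumFin V (λ _ → sparseCount V m k)
    ≤⟨ +-mono-≤ (sparseCount≤ V m (suc k) 1≤V)
                (≤-trans (≤-reflexive (sumFin-const V _)) (*-monoʳ-≤ V (sparseCount≤ V m k 1≤V))) ⟩
  (m + 1) * V * X + V * X
    ≡⟨ regroup (m + 1) V X ⟩
  X * ((m + 1) * V + V)
    ≤⟨ *-monoˡ-≤ ((m + 1) * V + V) (^-monoˡ-≤ k (*-monoˡ-≤ V (n≤1+n (m + 1)))) ⟩
  ((suc m + 1) * V) ^ k * ((m + 1) * V + V)
    ≡⟨ trans (*-comm _ ((m + 1) * V + V)) (cong (_* ((suc m + 1) * V) ^ k) (regroup′ m V)) ⟩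
  ((suc m + 1) * V) ^ suc k ∎
  where
  open ≤-Reasoning
  X : ℕ
  X = ((m + 1) * V) ^ k
  regroup : ∀ a V X → a * V * X + V * X ≡ X * (a * V + V)
  regroup = solve-∀
  regroup′ : ∀ m V → (m + 1) * V + V ≡ (suc m + 1) * V
  regroup′ = solve-∀

justs-tabulate : ∀ {V} n (f : Fin n → Maybe (Fin V)) → justs (tabulate f) ≡ sumFin n (𝟙 ∘ is-just ∘ f)
justs-tabulate zero    f = refl
justs-tabulate (suc n) f with f Fin.zero
... | nothing = justs-tabulate n (f ∘ Fin.suc)
... | just _  = cong suc (justs-tabulate n (f ∘ Fin.suc))

-- The two halves of a node

-- Inputs P ++ L ++ R₁ ++ R₂ with P, R₁ and R₂ fixed: L fills the left half and R₁ the right half of a node.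
module Phases {q w : ℕ} (A : Alg q w) {t₀ h r : ℕ} (P : Vec (Fin q) t₀) (R₁ : Vec (Fin q) h) (R₂ : Vec (Fin q) r) where

  input : Vec (Fin q) h → Vec (Fin q) (t₀ + (h + (h + r)))
  input L = P ++ (L ++ (R₁ ++ R₂))

  memP : Memory w
  memP = memAfter A 0 (initMem A) P

  memL : Vec (Fin q) h → Memory w
  memL L = memAfter A t₀ memP L

  traceP : Vec (Fin q × List (Word w)) t₀
  traceP = go A 0 (initMem A) P

  traceL traceR : Vec (Fin q) h → Vec (Fin q × List (Word w)) h
  traceL L = go A t₀ memP L
  traceR L = go A (t₀ + h) (memL L) R₁

  traceRest : Vec (Fin q) h → Vec (Fin q × List (Word w)) r
  traceRest L = go A (t₀ + h + h) (memAfter A (t₀ + h) (memL L) R₁) R₂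

  trace-input : ∀ L → trace A (input L) ≡ traceP ++ (traceL L ++ (traceR L ++ traceRest L))
  trace-input L = trans (go-++ A 0 (initMem A) P _)
                        (cong (traceP ++_) (trans (go-++ A t₀ memP L _) (cong (traceL L ++_) (go-++ A (t₀ + h) (memL L) R₁ R₂))))

  shared : Vec (Fin q) h → Word w → Bool
  shared L c = memb w c (allProbes w (traceL L)) ∧ memb w c (allProbes w (traceR L))

  transfer : Vec (Fin q) h → ℕ
  transfer L = sumFin (2 ^ w) (λ c → if shared L c then 1 else 0)

  module _ (1≤h : 1 ≤ h) where

    private
      suc∘pred : ∀ {n} → 1 ≤ n → suc (n ∸ 1) ≡ n
      suc∘pred 1≤n = sym (+-∸-assoc 1 1≤n)

      1≤t₀+h : 1 ≤ t₀ + h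
      1≤t₀+h = ≤-trans 1≤h (m≤n+m h t₀)

      1≤t₀+2h : 1 ≤ t₀ + 2 * h
      1≤t₀+2h = ≤-trans 1≤t₀+h (+-monoʳ-≤ t₀ (m≤m+n h (h + 0)))

    probes-left : ∀ L → probesIn w t₀ (t₀ + h ∸ 1) 0 (trace A (input L)) ≡ allProbes w (traceL L)
    probes-left L = trans (cong (probesIn w t₀ (t₀ + h ∸ 1) 0) (trace-input L))
                          (probesIn-block w t₀ (t₀ + h ∸ 1) 0 traceP (traceL L) _ refl (sym (suc∘pred 1≤t₀+h)))

    probes-right : ∀ L → probesIn w (suc (t₀ + h ∸ 1)) (t₀ + 2 * h ∸ 1) 0 (trace A (input L)) ≡ allProbes w (traceR L)
    probes-right L = begin
      probesIn w a b 0 (trace A (input L))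
        ≡⟨ cong (probesIn w a b 0) (trace-input L) ⟩
      probesIn w a b 0 (traceP ++ (traceL L ++ (traceR L ++ traceRest L)))
        ≡⟨ probesIn-++ w a b 0 traceP _ ⟩
      probesIn w a b 0 traceP ++ₗ probesIn w a b t₀ (traceL L ++ (traceR L ++ traceRest L))
        ≡⟨ cong₂ _++ₗ_ (probesIn-before w a b 0 traceP (≤-trans (m≤m+n t₀ h) (≤-reflexive (sym (suc∘pred 1≤t₀+h)))))
                       (probesIn-block w a b t₀ (traceL L) (traceR L) (traceRest L) (sym (suc∘pred 1≤t₀+h)) a+h≡) ⟩
      allProbes w (traceR L) ∎
      where
      open ≡-Reasoning
      a b : ℕ
      a = suc (t₀ + h ∸ 1)
      b = t₀ + 2 * h ∸ 1
      a+h≡ : a + h ≡ suc b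
      a+h≡ = begin
        suc (t₀ + h ∸ 1) + h  ≡⟨ cong (_+ h) (suc∘pred 1≤t₀+h) ⟩
        t₀ + h + h            ≡⟨ +-assoc t₀ h h ⟩
        t₀ + (h + h)          ≡⟨ cong (λ x → t₀ + (h + x)) (+-identityʳ h) ⟨
        t₀ + 2 * h            ≡⟨ suc∘pred 1≤t₀+2h ⟨
        suc b                 ∎

    -- For t₀ = i · 2^(j + 1) and h = 2^j the left-hand side is I A (input L) (j + 1) i.
    transfer-window : ∀ L →
      sumFin (2 ^ w) (λ c → if memb w c (probesIn w t₀ (t₀ + h ∸ 1) 0 (trace A (input L)))
                             ∧ memb w c (probesIn w (suc (t₀ + h ∸ 1)) (t₀ + 2 * h ∸ 1) 0 (trace A (input L)))
                          then 1 else 0)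
      ≡ transfer L
    transfer-window L = sumFin-cong (2 ^ w) λ c →
      cong (λ b → if b then 1 else 0) (cong₂ _∧_ (cong (memb w c) (probes-left L)) (cong (memb w c) (probes-right L)))

  entry : Vec (Fin q) h → Word w → Maybe (Word w)
  entry L c = if shared L c then just (memL L c) else nothing

  -- The information transferred from L to R₁: the cells probed in both phases with their contents
  -- after phase L.
  certificate : Vec (Fin q) h → Vec (Maybe (Word w)) (2 ^ w)
  certificate L = tabulate (entry L)

  justs-certificate : ∀ L → justs (certificate L) ≡ transfer L
  justs-certificate L = trans (justs-tabulate (2 ^ w) (entry L)) (sumFin-cong (2 ^ w) λ c → count (shared L c))
    where
    count : ∀ b {x : Word w} → 𝟙 (is-just (if b then just x else nothing)) ≡ (if b then 1 else 0)
    count true  = refl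
    count false = refl

  private
    entry-value : ∀ {b b′} {x x′ : Word w} → b ≡ true → b′ ≡ true →
                  (if b then just x else nothing) ≡ (if b′ then just x′ else nothing) → x ≡ x′
    entry-value refl refl = Maybeₚ.just-injective

    entry-shared : ∀ {b b′} {x x′ : Word w} → b ≡ true →
                   (if b then just x else nothing) ≡ (if b′ then just x′ else nothing) → b′ ≡ true
    entry-shared {b′ = true}  _    _  = refl
    entry-shared {b′ = false} refl ()

    entry≡ : ∀ L L′ → certificate L ≡ certificate L′ → ∀ c → entry L c ≡ entry L′ c
    entry≡ L L′ cert≡ c = trans (sym (Vecₚ.lookup∘tabulate (entry L) c))
                                (trans (cong (λ v → lookup v c) cert≡) (Vecₚ.lookup∘tabulate (entry L′) c))

  certificate-agree : ∀ L L′ → certificate L ≡ certificate L′ →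
                      AgreeOn w (allProbes w (traceR L)) (allProbes w (traceR L′)) (memL L) (memL L′)
  certificate-agree L L′ cert≡ c c∈R c∈R′
    with memb w c (allProbes w (traceL L)) in c∈L | memb w c (allProbes w (traceL L′)) in c∈L′
  ... | true  | true  = entry-value (∧-intro c∈L c∈R) (∧-intro c∈L′ c∈R′) (entry≡ L L′ cert≡ c)
  ... | true  | false =
    contradiction (trans (sym c∈L′) (proj₁ (∧-true (entry-shared (∧-intro c∈L c∈R) (entry≡ L L′ cert≡ c))))) λ ()
  ... | false | true  =
    contradiction (trans (sym c∈L) (proj₁ (∧-true (entry-shared (∧-intro c∈L′ c∈R′) (sym (entry≡ L L′ cert≡ c)))))) λ ()
  ... | false | false = trans (memAfter-unprobed A t₀ memP L c c∈L) (sym (memAfter-unprobed A t₀ memP L′ c c∈L′))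

  certificate⇒traceR : ∀ L L′ → certificate L ≡ certificate L′ → traceR L ≡ traceR L′
  certificate⇒traceR L L′ cert≡ = go-agree A (t₀ + h) (memL L) (memL L′) R₁ (certificate-agree L L′ cert≡)

  val-input : ∀ L → val q (input L) ≡ val q P + q ^ t₀ * (val q L + q ^ h * val q (R₁ ++ R₂))
  val-input L = trans (val-++ q P _) (cong (λ v → val q P + q ^ t₀ * v) (val-++ q L (R₁ ++ R₂)))

  lookup-traceR : ∀ L (s : Fin h) → lookup (trace A (input L)) (t₀ ↑ʳ (h ↑ʳ (s ↑ˡ r))) ≡ lookup (traceR L) s
  lookup-traceR L s = trans (cong (λ v → lookup v (t₀ ↑ʳ (h ↑ʳ (s ↑ˡ r)))) (trace-input L))
                     (trans (Vecₚ.lookup-++ʳ traceP _ _) (trans (Vecₚ.lookup-++ʳ (traceL L) _ _) (Vecₚ.lookup-++ˡ (traceR L) (traceRest L) s)))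

-- Inputs sharing a certificate

module Fibres {q w : ℕ} (2≤q : 2 ≤ q) (A : Alg q w) {t₀ h r : ℕ}
  (P : Vec (Fin q) t₀) (R₁ : Vec (Fin q) h) (R₂ : Vec (Fin q) r) (F : ℕ)
  (correct : ∀ (U : Vec (Fin q) (t₀ + (h + (h + r)))) t → toℕ (proj₁ (lookup (trace A U) t)) ≡ digit q 2≤q (toℕ t) (F * val q U))
  where

  open Phases A P R₁ R₂
  open Window q 2≤q t₀ h

  _≟ᶜ_ : (u v : Vec (Maybe (Word w)) (2 ^ w)) → Dec (u ≡ v)
  _≟ᶜ_ = Vecₚ.≡-dec (Maybeₚ.≡-dec Fin._≟_)

  traceR-digit : ∀ L s → toℕ (proj₁ (lookup (traceR L) s))
                        ≡ digit q 2≤q (t₀ + h + toℕ s) (F * (val q P + q ^ t₀ * (val q L + q ^ h * val q (R₁ ++ R₂))))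
  traceR-digit L s = begin
    toℕ (proj₁ (lookup (traceR L) s))
      ≡⟨ cong (toℕ ∘′ proj₁) (lookup-traceR L s) ⟨
    toℕ (proj₁ (lookup (trace A (input L)) (t₀ ↑ʳ (h ↑ʳ (s ↑ˡ r)))))
      ≡⟨ correct (input L) _ ⟩
    digit q 2≤q (toℕ (t₀ ↑ʳ (h ↑ʳ (s ↑ˡ r)))) (F * val q (input L))
      ≡⟨ cong₂ (λ t v → digit q 2≤q t (F * v)) position (val-input L) ⟩
    digit q 2≤q (t₀ + h + toℕ s) (F * (val q P + q ^ t₀ * (val q L + q ^ h * val q (R₁ ++ R₂)))) ∎
    where
    open ≡-Reasoning
    position : toℕ (t₀ ↑ʳ (h ↑ʳ (s ↑ˡ r))) ≡ t₀ + h + toℕ s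
    position = trans (toℕ-↑ʳ t₀ _) (trans (cong (t₀ +_) (trans (toℕ-↑ʳ h _) (cong (h +_) (toℕ-↑ˡ s r)))) (sym (+-assoc t₀ h _)))

  certificate⇒middleBlock : ∀ L L′ → certificate L ≡ certificate L′ →
    middleBlock (carry F (val q P)) F (val q L) ≡ middleBlock (carry F (val q P)) F (val q L′)
  certificate⇒middleBlock L L′ cert≡ = digits⇒middleBlock F (val q P) (val q (R₁ ++ R₂)) (val q L) (val q L′) λ s s<h →
    let i = fromℕ< s<h in
    subst (λ s → digit q 2≤q (t₀ + h + s) _ ≡ digit q 2≤q (t₀ + h + s) _) (toℕ-fromℕ< s<h)
      (trans (sym (traceR-digit L i))
             (trans (cong (λ R → toℕ (proj₁ (lookup R i))) (certificate⇒traceR L L′ cert≡)) (traceR-digit L′ i)))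

  certificate-fibre : ∀ v → sumVec q h (λ L → 𝟙 (does (v ≟ᶜ certificate L))) ≤ multiplicity F
  certificate-fibre v with 0 <? sumVec q h (λ L → 𝟙 (does (v ≟ᶜ certificate L)))
  ... | no  empty = ≤-trans (≮⇒≥ empty) z≤n
  ... | yes nonempty with sumVec-positive q h _ nonempty
  ...   | L₀ , v≡L₀ = begin
    sumVec q h (λ L → 𝟙 (does (v ≟ᶜ certificate L)))
      ≤⟨ sumVec-mono q h (λ L → 𝟙≤ _ λ v≡L → 1≤𝟙 (dec-true (_ ≟ _) (sameBlock L (fromDoes (v ≟ᶜ _) v≡L)))) ⟩
    sumVec q h (λ L → 𝟙 (does (D (val q L) ≟ D (val q L₀))))
      ≡⟨ sumVec-val q h (λ x → 𝟙 (does (D x ≟ D (val q L₀)))) ⟩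
    sumBelow (q ^ h) (λ x → 𝟙 (does (D x ≟ D (val q L₀))))
      ≤⟨ middleBlock-fibre (carry F (val q P)) F (val< q L₀) ⟩
    multiplicity F ∎
    where
    open ≤-Reasoning
    D : ℕ → ℕ
    D = middleBlock (carry F (val q P)) F
    sameBlock : ∀ L → v ≡ certificate L → D (val q L) ≡ D (val q L₀)
    sameBlock L v≡L = certificate⇒middleBlock L L₀ (trans (sym v≡L) (fromDoes (v ≟ᶜ _) (0<𝟙⇒true v≡L₀)))

  -- Each L with transfer L ≤ k has a certificate with at most k entries, shared by at most
  -- multiplicity F inputs.
  lowTransfer-count : ∀ k → sumVec q h (λ L → 𝟙 (does (transfer L ≤? k))) ≤ sparseCount (2 ^ w) (2 ^ w) k * multiplicity F
  lowTransfer-count k = begin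
    sumVec q h (λ L → 𝟙 (does (transfer L ≤? k)))
      ≤⟨ sumVec-mono q h (λ L → 𝟙≤ _ λ low → ≤-trans (1≤𝟙 (dec-true (certificate L ≟ᶜ certificate L) refl))
                                                   (sumSparse-term (2 ^ w) (2 ^ w) k _ (certificate L)
                                                     (≤-trans (≤-reflexive (justs-certificate L)) (fromDoes (_ ≤? k) low)))) ⟩
    sumVec q h (λ L → sumSparse (2 ^ w) (2 ^ w) k (λ v → 𝟙 (does (v ≟ᶜ certificate L))))
      ≡⟨ sumVec-sumSparse q h (2 ^ w) (2 ^ w) k _ ⟩
    sumSparse (2 ^ w) (2 ^ w) k (λ v → sumVec q h (λ L → 𝟙 (does (v ≟ᶜ certificate L))))
      ≤⟨ sumSparse-mono (2 ^ w) (2 ^ w) k (λ v → ≤-trans (certificate-fibre v) (≤-reflexive (sym (*-identityˡ (multiplicity F))))) ⟩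
    sumSparse (2 ^ w) (2 ^ w) k (λ _ → 1 * multiplicity F)
      ≡⟨ sumSparse-*ʳ (2 ^ w) (2 ^ w) k (λ _ → 1) (multiplicity F) ⟩
    sparseCount (2 ^ w) (2 ^ w) k * multiplicity F ∎
    where open ≤-Reasoning

  transfer-sum : ∀ k → (k + 1) * q ^ h ≤ sumVec q h transfer + (k + 1) * (sparseCount (2 ^ w) (2 ^ w) k * multiplicity F)
  transfer-sum k = begin
    (k + 1) * q ^ h
      ≡⟨ trans (*-comm (k + 1) (q ^ h)) (sym (sumVec-const q h (k + 1))) ⟩
    sumVec q h (λ _ → k + 1)
      ≤⟨ sumVec-mono q h (λ L → split (transfer L)) ⟩
    sumVec q h (λ L → transfer L + (k + 1) * 𝟙 (does (transfer L ≤? k)))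
      ≡⟨ trans (sumVec-+ q h _ _) (cong (sumVec q h transfer +_) (sumVec-* q h (k + 1) _)) ⟩
    sumVec q h transfer + (k + 1) * sumVec q h (λ L → 𝟙 (does (transfer L ≤? k)))
      ≤⟨ +-monoʳ-≤ (sumVec q h transfer) (*-monoʳ-≤ (k + 1) (lowTransfer-count k)) ⟩
    sumVec q h transfer + (k + 1) * (sparseCount (2 ^ w) (2 ^ w) k * multiplicity F) ∎
    where
    open ≤-Reasoning
    split : ∀ t → k + 1 ≤ t + (k + 1) * 𝟙 (does (t ≤? k))
    split t = 𝟙-does (λ x → k + 1 ≤ t + (k + 1) * x) (t ≤? k)
      (λ _ → ≤-trans (≤-reflexive (sym (*-identityʳ (k + 1)))) (m≤n+m _ t))
      (λ t≰k → ≤-trans (≤-trans (≤-reflexive (+-comm k 1)) (≰⇒> t≰k)) (m≤m+n t _))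

-- Summing over all operands and inputs

-- The node at height 1 + j′ and index i: its halves are the arrivals [first, first + h) and [first + h, first + 2h),
-- followed by r further arrivals.
module Node (q : ℕ) (2≤q : 2 ≤ q) (w j′ i r : ℕ) where

  h first n : ℕ
  h = 2 ^ j′
  first = i * 2 ^ suc j′
  n = first + (h + (h + r))

  private instance
    q≢0 : NonZero q
    q≢0 = >-nonZero (≤-trans (s≤s z≤n) 2≤q)

  open Window q 2≤q first h using (M; M≢0; nearZeroCount; multiplicity; nearZeroCount-sum; nearZeroCount-Q; ≡Q-count)

  N Q N′ : ℕ
  N = q ^ n
  Q = q ^ h
  N′ = q ^ first * (q ^ h * q ^ r)

  certs : ℕ → ℕ
  certs k = sparseCount (2 ^ w) (2 ^ w) k

  1≤h : 1 ≤ h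
  1≤h = >-nonZero⁻¹ h {{m^n≢0 2 j′}}

  2≤Q : 2 ≤ Q
  2≤Q = ≤-trans 2≤q (≤-trans (≤-reflexive (sym (*-identityʳ q))) (^-monoʳ-≤ q 1≤h))

  N-expand : N ≡ q ^ first * (Q * (Q * q ^ r))
  N-expand = trans (^-distribˡ-+-* q first _) (cong (q ^ first *_) (trans (^-distribˡ-+-* q h _) (cong (Q *_) (^-distribˡ-+-* q h r))))

  N≡N′*Q : N ≡ N′ * Q
  N≡N′*Q = trans N-expand (regroup (q ^ first) Q (q ^ r))
    where
    regroup : ∀ a Q c → a * (Q * (Q * c)) ≡ a * (Q * c) * Q
    regroup = solve-∀

  N≡M*m : N ≡ M * q ^ (first + r)
  N≡M*m = trans N-expand (trans (regroup (q ^ first) Q (q ^ r)) (cong (M *_) (sym (^-distribˡ-+-* q first r))))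
    where
    regroup : ∀ a Q c → a * (Q * (Q * c)) ≡ Q * Q * (a * c)
    regroup = solve-∀

  sumB≤ : sumBelow N multiplicity ≤ 13 * N
  sumB≤ = begin
    sumBelow N multiplicity
      ≡⟨ trans (sumFin-+ N _ _) (cong₂ _+_ (trans (sumFin-const N 1) (*-identityʳ N)) (sumFin-+ N _ _)) ⟩
    N + (sumBelow N nearZeroCount + sumBelow N nearZeroCount)
      ≤⟨ +-monoʳ-≤ N (+-mono-≤ count count) ⟩
    N + (6 * N + 6 * N)
      ≡⟨ regroup N ⟩
    13 * N ∎
    where
    open ≤-Reasoning
    regroup : ∀ N → N + (6 * N + 6 * N) ≡ 13 * N
    regroup = solve-∀
    count : sumBelow N nearZeroCount ≤ 6 * N
    count = subst (λ x → sumBelow x nearZeroCount ≤ 6 * x) (sym N≡M*m)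
                  (nearZeroCount-sum _ (>-nonZero⁻¹ _ {{m^n≢0 q (first + r)}}))

  split-input : ∀ (f : Vec (Fin q) n → ℕ) →
    sumVec q n f ≡ sumVec q first (λ P → sumVec q h (λ R₁ → sumVec q r (λ R₂ → sumVec q h (λ L → f (P ++ (L ++ (R₁ ++ R₂)))))))
  split-input f =
    trans (sumVec-++ q first _ f) (sumVec-cong q first λ P →
    trans (sumVec-++ q h _ _) (trans (sumVec-cong q h (λ L → sumVec-++ q h r _))
    (trans (sumVec-comm q h h _) (sumVec-cong q h (λ R₁ → sumVec-comm q h r _)))))

  module _ (alg : Fin N → Alg q w) where

    inner : Fin N → ℕ
    inner F = sumVec q n (λ U → I (alg F) U (suc j′) i)

    total : ℕ
    total = totalI q w n alg (suc j′) i

  module _ (alg : Fin N → Alg q w) (correct : Correct q 2≤q w n alg) where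

    inner-bound : ∀ k F → (k + 1) * N ≤ inner alg F + (k + 1) * (certs k * (N′ * multiplicity (toℕ F)))
    inner-bound k F = subst₂ _≤_ lhs≡ (cong₂ _+_ (sym (split-input (λ U → I (alg F) U (suc j′) i))) rhs≡)
      (sumVec-≥ q first _ _ _ λ P → sumVec-≥ q h _ _ _ λ R₁ → sumVec-≥ q r _ _ _ λ R₂ →
        subst (λ s → (k + 1) * Q ≤ s + (k + 1) * (certs k * multiplicity (toℕ F)))
              (sumVec-cong q h (λ L → sym (Phases.transfer-window (alg F) P R₁ R₂ 1≤h L)))
              (transfer-sum 2≤q (alg F) P R₁ R₂ (toℕ F) (correct F) k))
      where
      open Fibres using (transfer-sum)
      lhs≡ : q ^ first * (q ^ h * (q ^ r * ((k + 1) * Q))) ≡ (k + 1) * N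
      lhs≡ = trans (regroup (q ^ first) Q (q ^ r) (k + 1)) (cong ((k + 1) *_) (sym N-expand))
        where
        regroup : ∀ a Q c k → a * (Q * (c * (k * Q))) ≡ k * (a * (Q * (Q * c)))
        regroup = solve-∀
      rhs≡ : q ^ first * (q ^ h * (q ^ r * ((k + 1) * (certs k * multiplicity (toℕ F)))))
           ≡ (k + 1) * (certs k * (N′ * multiplicity (toℕ F)))
      rhs≡ = regroup (q ^ first) Q (q ^ r) (k + 1) (certs k) (multiplicity (toℕ F))
        where
        regroup : ∀ a Q c k e b → a * (Q * (c * (k * (e * b)))) ≡ k * (e * (a * (Q * c) * b))
        regroup = solve-∀

    total-bound : ∀ k → (k + 1) * (N * N) ≤ total alg + (k + 1) * (certs k * (N′ * (13 * N)))
    total-bound k = begin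
      (k + 1) * (N * N)
        ≡⟨ trans (regroup (k + 1) N) (sym (sumFin-const N _)) ⟩
      sumFin N (λ _ → (k + 1) * N)
        ≤⟨ sumFin-mono N (inner-bound k) ⟩
      sumFin N (λ F → inner alg F + (k + 1) * (certs k * (N′ * multiplicity (toℕ F))))
        ≡⟨ trans (sumFin-+ N (inner alg) _) (cong (total alg +_) pull-out) ⟩
      total alg + (k + 1) * (certs k * (N′ * sumBelow N multiplicity))
        ≤⟨ +-monoʳ-≤ (total alg) (*-monoʳ-≤ (k + 1) (*-monoʳ-≤ (certs k) (*-monoʳ-≤ N′ sumB≤))) ⟩
      total alg + (k + 1) * (certs k * (N′ * (13 * N))) ∎
      where
      open ≤-Reasoning
      regroup : ∀ k N → k * (N * N) ≡ N * (k * N)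
      regroup = solve-∀
      pull-out : sumFin N (λ F → (k + 1) * (certs k * (N′ * multiplicity (toℕ F))))
               ≡ (k + 1) * (certs k * (N′ * sumBelow N multiplicity))
      pull-out = trans (sumFin-* N (k + 1) _) (cong ((k + 1) *_)
                 (trans (sumFin-* N (certs k) _) (cong (certs k *_) (sumFin-* N N′ (multiplicity ∘ toℕ)))))

    total-large : ∀ k → 26 * certs k ≤ Q → (k + 1) * (N * N) ≤ 2 * total alg
    total-large k 26certs≤Q = +-cancelˡ-≤ X _ _ (begin
      X + X                                ≤⟨ +-mono-≤ (total-bound k) (total-bound k) ⟩
      (total alg + Y) + (total alg + Y)    ≡⟨ regroup (total alg) Y ⟩
      (Y + Y) + 2 * total alg              ≤⟨ +-monoˡ-≤ (2 * total alg) 2Y≤X ⟩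
      X + 2 * total alg                    ∎)
      where
      open ≤-Reasoning
      X Y : ℕ
      X = (k + 1) * (N * N)
      Y = (k + 1) * (certs k * (N′ * (13 * N)))
      regroup : ∀ t y → (t + y) + (t + y) ≡ (y + y) + 2 * t
      regroup = solve-∀
      2Y≤X : Y + Y ≤ X
      2Y≤X = begin
        Y + Y                                ≡⟨ regroup′ (k + 1) (certs k) N′ N ⟩
        (k + 1) * N′ * (26 * certs k) * N    ≤⟨ *-monoˡ-≤ N (*-monoʳ-≤ ((k + 1) * N′) 26certs≤Q) ⟩
        (k + 1) * N′ * Q * N                 ≡⟨ cong (_* N) (*-assoc (k + 1) N′ Q) ⟩
        (k + 1) * (N′ * Q) * N               ≡⟨ cong (λ x → (k + 1) * x * N) N≡N′*Q ⟨
        (k + 1) * N * N                      ≡⟨ *-assoc (k + 1) N N ⟩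
        X                                    ∎
        where
        regroup′ : ∀ k e N′ N → k * (e * (N′ * (13 * N))) + k * (e * (N′ * (13 * N))) ≡ k * N′ * (26 * e) * N
        regroup′ = solve-∀

    -- For F ≡ Q modulo Q² no e ∈ (0, Q) is a near-zero multiplier, so every input L is charged.
    inner-special : ∀ F → toℕ F % M ≡ Q → N′ ≤ inner alg F
    inner-special F F%M≡Q = +-cancelʳ-≤ N′ _ _ (begin
      N′ + N′                                            ≡⟨ regroup N′ ⟩
      N′ * 2                                             ≤⟨ *-monoʳ-≤ N′ 2≤Q ⟩
      N′ * Q                                             ≡⟨ trans (sym N≡N′*Q) (sym (+-identityʳ N)) ⟩
      1 * N                                              ≤⟨ inner-bound 0 F ⟩
      inner alg F + 1 * (certs 0 * (N′ * multiplicity (toℕ F)))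
                                                         ≡⟨ cong (inner alg F +_) (trans (+-identityʳ _) correction≡N′) ⟩
      inner alg F + N′                                   ∎)
      where
      open ≤-Reasoning
      regroup : ∀ a → a + a ≡ a * 2
      regroup = solve-∀
      correction≡N′ : certs 0 * (N′ * multiplicity (toℕ F)) ≡ N′
      correction≡N′ = begin-equality
        certs 0 * (N′ * multiplicity (toℕ F))            ≡⟨ cong (_* (N′ * multiplicity (toℕ F))) (sparseCount-zero (2 ^ w) (2 ^ w)) ⟩
        1 * (N′ * (1 + (nearZeroCount (toℕ F) + nearZeroCount (toℕ F))))
                                                         ≡⟨ cong (λ c → 1 * (N′ * (1 + (c + c)))) (nearZeroCount-Q (toℕ F) F%M≡Q) ⟩
        1 * (N′ * 1)                                     ≡⟨ trans (*-identityˡ _) (*-identityʳ N′) ⟩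
        N′                                               ∎

    total-small : N * N ≤ Q * Q * Q * total alg
    total-small = begin
      N * N                                                ≡⟨ cong₂ _*_ N≡M*m N≡N′*Q ⟩
      M * q ^ (first + r) * (N′ * Q)                       ≡⟨ regroup Q (q ^ (first + r)) N′ ⟩
      Q * Q * Q * (N′ * q ^ (first + r))                   ≤⟨ *-monoʳ-≤ (Q * Q * Q) (*-monoʳ-≤ N′ (≡Q-count _ 2≤Q)) ⟩
      Q * Q * Q * (N′ * sumBelow (M * q ^ (first + r)) special)
                                                           ≡⟨ cong (λ x → Q * Q * Q * (N′ * sumBelow x special)) N≡M*m ⟨
      Q * Q * Q * (N′ * sumBelow N special)                ≡⟨ cong (Q * Q * Q *_) (sumFin-* N N′ (special ∘ toℕ)) ⟨
      Q * Q * Q * sumFin N (λ F → N′ * special (toℕ F))    ≤⟨ *-monoʳ-≤ (Q * Q * Q) (sumFin-mono N charged) ⟩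
      Q * Q * Q * total alg                                ∎
      where
      open ≤-Reasoning
      regroup : ∀ Q m N′ → Q * Q * m * (N′ * Q) ≡ Q * Q * Q * (N′ * m)
      regroup = solve-∀
      special : ℕ → ℕ
      special F = 𝟙 (does (F % M ≟ Q))
      charged : ∀ F → N′ * special (toℕ F) ≤ inner alg F
      charged F = 𝟙-does (λ x → N′ * x ≤ inner alg F) (toℕ F % M ≟ Q)
        (λ F%M≡Q → ≤-trans (≤-reflexive (*-identityʳ N′)) (inner-special F F%M≡Q))
        (λ _ → ≤-trans (≤-reflexive (*-zeroʳ N′)) z≤n)

-- Choice of the level k

2^⌊log₂n⌋≤n : ∀ n → 1 ≤ n → 2 ^ ⌊log₂ n ⌋ ≤ n
2^⌊log₂n⌋≤n n = bound n (<-wellFounded n)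
  where
  bound : ∀ n (rec : Acc _<_ n) → 1 ≤ n → 2 ^ ⌊log2⌋ n rec ≤ n
  bound 1             _       _ = ≤-refl
  bound (suc (suc m)) (acc _) _ = begin
    2 * 2 ^ ⌊log2⌋ (suc ⌊ m /2⌋) _   ≤⟨ *-monoʳ-≤ 2 (bound (suc ⌊ m /2⌋) _ (s≤s z≤n)) ⟩
    2 * suc ⌊ m /2⌋                   ≡⟨ regroup ⌊ m /2⌋ ⟩
    suc (suc (⌊ m /2⌋ + ⌊ m /2⌋))     ≤⟨ s≤s (s≤s (≤-trans (+-monoʳ-≤ ⌊ m /2⌋ (⌊n/2⌋≤⌈n/2⌉ m))
                                                         (≤-reflexive (⌊n/2⌋+⌈n/2⌉≡n m)))) ⟩
    suc (suc m)                       ∎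
    where
    open ≤-Reasoning
    regroup : ∀ x → 2 * suc x ≡ suc (suc (x + x))
    regroup = solve-∀

2^δ≤q : ∀ q → 2 ≤ q → 2 ^ δ q ≤ q
2^δ≤q q 2≤q = 2^⌊log₂n⌋≤n q (≤-trans (s≤s z≤n) 2≤q)

sparseCount≤2^ : ∀ w k → sparseCount (2 ^ w) (2 ^ w) k ≤ 2 ^ (suc (2 * w) * k)
sparseCount≤2^ w k = begin
  sparseCount (2 ^ w) (2 ^ w) k     ≤⟨ sparseCount≤ (2 ^ w) (2 ^ w) k 1≤2^w ⟩
  ((2 ^ w + 1) * 2 ^ w) ^ k         ≤⟨ ^-monoˡ-≤ k (*-monoˡ-≤ (2 ^ w) (+-monoʳ-≤ (2 ^ w) 1≤2^w)) ⟩
  ((2 ^ w + 2 ^ w) * 2 ^ w) ^ k     ≡⟨ cong (_^ k) (trans (regroup (2 ^ w)) (cong (2 *_) (sym (^-distribˡ-+-* 2 w w)))) ⟩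
  (2 ^ suc (w + w)) ^ k             ≡⟨ ^-*-assoc 2 (suc (w + w)) k ⟩
  2 ^ (suc (w + w) * k)             ≡⟨ cong (λ e → 2 ^ (e * k)) (regroup′ w) ⟩
  2 ^ (suc (2 * w) * k)             ∎
  where
  open ≤-Reasoning
  1≤2^w : 1 ≤ 2 ^ w
  1≤2^w = >-nonZero⁻¹ (2 ^ w) {{m^n≢0 2 w}}
  regroup : ∀ x → (x + x) * x ≡ 2 * (x * x)
  regroup = solve-∀
  regroup′ : ∀ w → suc (w + w) ≡ suc (2 * w)
  regroup′ = solve-∀

-- 32 would do when Q ≥ 26; the case Q < 26, which uses only the operands F ≡ Q (mod Q²), needs 8 · 26³.
transferConstant : ℕ
transferConstant = 8 * 26 ^ 3

transferConstant-large : ∀ w k x y t → x ≤ 8 * w * (k + 1) → (k + 1) * y ≤ 2 * t → 2 * x * y ≤ transferConstant * w * t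
transferConstant-large w k x y t x≤ y≤ = begin
  2 * x * y                    ≤⟨ *-monoˡ-≤ y (*-monoʳ-≤ 2 x≤) ⟩
  2 * (8 * w * (k + 1)) * y    ≡⟨ regroup w (k + 1) y ⟩
  16 * w * ((k + 1) * y)       ≤⟨ *-monoʳ-≤ (16 * w) y≤ ⟩
  16 * w * (2 * t)             ≡⟨ regroup′ w t ⟩
  32 * w * t                   ≤⟨ *-monoˡ-≤ t (*-monoˡ-≤ w {32} {transferConstant} (m≤m+n 32 140576)) ⟩
  transferConstant * w * t     ∎
  where
  open ≤-Reasoning
  regroup : ∀ w k y → 2 * (8 * w * k) * y ≡ 16 * w * (k * y)
  regroup = solve-∀
  regroup′ : ∀ w t → 16 * w * (2 * t) ≡ 32 * w * t
  regroup′ = solve-∀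

transferConstant-small : ∀ w Q x y t → 1 ≤ w → Q ≤ 26 → x ≤ 4 → y ≤ Q * Q * Q * t → 2 * x * y ≤ transferConstant * w * t
transferConstant-small w Q x y t 1≤w Q≤26 x≤4 y≤ = begin
  2 * x * y                    ≤⟨ *-monoˡ-≤ y (*-monoʳ-≤ 2 x≤4) ⟩
  8 * y                        ≤⟨ *-monoʳ-≤ 8 y≤ ⟩
  8 * (Q * Q * Q * t)          ≤⟨ *-monoʳ-≤ 8 (*-monoˡ-≤ t (*-mono-≤ (*-mono-≤ Q≤26 Q≤26) Q≤26)) ⟩
  8 * (26 * 26 * 26 * t)       ≡⟨ *-assoc 8 (26 * 26 * 26) t ⟨
  transferConstant * t         ≤⟨ *-monoˡ-≤ t (≤-trans (≤-reflexive (sym (*-identityʳ transferConstant)))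
                                                       (*-monoʳ-≤ transferConstant 1≤w)) ⟩
  transferConstant * w * t     ∎
  where open ≤-Reasoning

module _ (q : ℕ) (2≤q : 2 ≤ q) (w : ℕ) (1≤w : 1 ≤ w) (j′ i r : ℕ) where

  open Node q 2≤q w j′ i r

  private
    D k : ℕ
    D = suc (2 * w)
    k = (δ q * h ∸ 5) / D

    2^δh≤Q : 2 ^ (δ q * h) ≤ Q
    2^δh≤Q = ≤-trans (≤-reflexive (sym (^-*-assoc 2 (δ q) h))) (^-monoˡ-≤ h (2^δ≤q q 2≤q))

    -- k is the largest level with 2⁵ · 2^(D k) ≤ 2^(δ h), so that δ h is of order D (k + 1).
    δh≤ : δ q * h ≤ 8 * w * (k + 1)
    δh≤ = begin
      δ q * h                                ≤⟨ m≤n+m∸n (δ q * h) 5 ⟩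
      5 + (δ q * h ∸ 5)                      ≤⟨ +-monoʳ-≤ 5 (<⇒≤ remainder<) ⟩
      5 + (k + 1) * D                        ≤⟨ +-monoˡ-≤ ((k + 1) * D) (*-monoʳ-≤ 5 (m≤n+m 1 k)) ⟩
      5 * (k + 1) + (k + 1) * D              ≡⟨ regroup k w ⟩
      6 * (k + 1) + 2 * w * (k + 1)          ≤⟨ +-monoˡ-≤ (2 * w * (k + 1)) (*-monoʳ-≤ 6 k+1≤w*[k+1]) ⟩
      6 * (w * (k + 1)) + 2 * w * (k + 1)    ≡⟨ regroup′ k w ⟩
      8 * w * (k + 1)                        ∎
      where
      open ≤-Reasoning
      regroup : ∀ k w → 5 * (k + 1) + (k + 1) * suc (2 * w) ≡ 6 * (k + 1) + 2 * w * (k + 1)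
      regroup = solve-∀
      regroup′ : ∀ k w → 6 * (w * (k + 1)) + 2 * w * (k + 1) ≡ 8 * w * (k + 1)
      regroup′ = solve-∀
      k+1≤w*[k+1] : k + 1 ≤ w * (k + 1)
      k+1≤w*[k+1] = ≤-trans (≤-reflexive (sym (*-identityˡ (k + 1)))) (*-monoˡ-≤ (k + 1) 1≤w)
      remainder< : δ q * h ∸ 5 < (k + 1) * D
      remainder< = begin-strict
        δ q * h ∸ 5                          ≡⟨ m≡m%n+[m/n]*n (δ q * h ∸ 5) D ⟩
        (δ q * h ∸ 5) % D + k * D            <⟨ +-monoˡ-< (k * D) (m%n<n (δ q * h ∸ 5) D) ⟩
        D + k * D                            ≡⟨ regroup″ k D ⟩
        (k + 1) * D                          ∎
        where
        regroup″ : ∀ k D → D + k * D ≡ (k + 1) * D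
        regroup″ = solve-∀

    26certs≤Q : 26 ≤ Q → 26 * certs k ≤ Q
    26certs≤Q 26≤Q with 5 ≤? δ q * h
    ... | yes 5≤δh = begin
      26 * certs k                     ≤⟨ *-mono-≤ (m≤m+n 26 6) (sparseCount≤2^ w k) ⟩
      2 ^ 5 * 2 ^ (D * k)          ≡⟨ ^-distribˡ-+-* 2 5 (D * k) ⟨
      2 ^ (5 + D * k)              ≤⟨ ^-monoʳ-≤ 2 (+-monoʳ-≤ 5 (≤-trans (≤-reflexive (*-comm D k))
                                                                      (m/n*n≤m (δ q * h ∸ 5) D))) ⟩
      2 ^ (5 + (δ q * h ∸ 5))      ≡⟨ cong (2 ^_) (m+[n∸m]≡n 5≤δh) ⟩
      2 ^ (δ q * h)                ≤⟨ 2^δh≤Q ⟩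
      Q                            ∎
      where open ≤-Reasoning
    ... | no  δh<5 = subst (λ e → 26 * e ≤ Q) (sym E≡1) 26≤Q
      where
      k≡0 : k ≡ 0
      k≡0 = trans (cong (_/ D) (m≤n⇒m∸n≡0 (<⇒≤ (≰⇒> δh<5)))) (0/n≡0 D)
      E≡1 : certs k ≡ 1
      E≡1 = trans (cong certs k≡0) (sparseCount-zero (2 ^ w) (2 ^ w))

  node-lowerBound : (alg : Fin N → Alg q w) → Correct q 2≤q w n alg →
                    δ q * 2 ^ suc j′ * (N * N) ≤ transferConstant * w * total alg
  node-lowerBound alg correct =
    subst (_≤ transferConstant * w * total alg) (sym (regroup (δ q) h (N * N))) large-or-small
    where
    regroup : ∀ d h x → d * (2 * h) * x ≡ 2 * (d * h) * x
    regroup = solve-∀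
    large-or-small : 2 * (δ q * h) * (N * N) ≤ transferConstant * w * total alg
    large-or-small with 26 ≤? Q
    ... | yes 26≤Q =
      transferConstant-large w k (δ q * h) (N * N) (total alg) δh≤ (total-large alg correct k (26certs≤Q 26≤Q))
    ... | no  Q≮26 =
      transferConstant-small w Q (δ q * h) (N * N) (total alg) 1≤w (<⇒≤ (≰⇒> Q≮26)) δh≤4 (total-small alg correct)
      where
      δh≤4 : δ q * h ≤ 4
      δh≤4 with 5 ≤? δ q * h
      ... | no  δh<5 = ≤-pred (≰⇒> δh<5)
      ... | yes 5≤δh = ⊥-elim (Q≮26 (≤-trans (m≤m+n 26 6) (≤-trans (^-monoʳ-≤ 2 5≤δh) 2^δh≤Q)))

  -- Stated for every m ≡ n, so that an input length 2 ^ d can be matched against the node's n.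
  node-lowerBound′ : ∀ {m} → m ≡ n → (alg : Fin (q ^ m) → Alg q w) → Correct q 2≤q w m alg →
                     δ q * 2 ^ suc j′ * (q ^ m * q ^ m) ≤ transferConstant * w * totalI q w m alg (suc j′) i
  node-lowerBound′ refl = node-lowerBound

node-fits : ∀ d j′ i → suc j′ ≤ d → i < 2 ^ (d ∸ suc j′) → i * 2 ^ suc j′ + (2 ^ j′ + 2 ^ j′) ≤ 2 ^ d
node-fits d j′ i j≤d i< = begin
  i * 2 ^ suc j′ + (2 ^ j′ + 2 ^ j′)      ≡⟨ cong (λ x → i * 2 ^ suc j′ + (2 ^ j′ + x)) (+-identityʳ (2 ^ j′)) ⟨
  i * 2 ^ suc j′ + 2 ^ suc j′            ≡⟨ +-comm (i * 2 ^ suc j′) _ ⟩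
  suc i * 2 ^ suc j′                     ≤⟨ *-monoˡ-≤ (2 ^ suc j′) i< ⟩
  2 ^ (d ∸ suc j′) * 2 ^ suc j′          ≡⟨ ^-distribˡ-+-* 2 (d ∸ suc j′) (suc j′) ⟨
  2 ^ (d ∸ suc j′ + suc j′)              ≡⟨ cong (2 ^_) (m∸n+n≡m j≤d) ⟩
  2 ^ d                                  ∎
  where open ≤-Reasoning

tree-lowerBound : ∀ q (2≤q : 2 ≤ q) w → 1 ≤ w → ∀ d (alg : Fin (q ^ (2 ^ d)) → Alg q w) → Correct q 2≤q w (2 ^ d) alg →
                  ∀ j i → 1 ≤ j → j ≤ d → i < 2 ^ (d ∸ j) →
                  δ q * 2 ^ j * (q ^ (2 ^ d) * q ^ (2 ^ d)) ≤ transferConstant * w * totalI q w (2 ^ d) alg j i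
tree-lowerBound q 2≤q w 1≤w d alg correct (suc j′) i _ j≤d i< = node-lowerBound′ q 2≤q w 1≤w j′ i r 2^d≡ alg correct
  where
  first h r : ℕ
  first = i * 2 ^ suc j′
  h = 2 ^ j′
  r = 2 ^ d ∸ (first + (h + h))
  2^d≡ : 2 ^ d ≡ first + (h + (h + r))
  2^d≡ = trans (sym (m+[n∸m]≡n (node-fits d j′ i j≤d i<))) (regroup first h r)
    where
    regroup : ∀ a b c → a + (b + b) + c ≡ a + (b + (b + c))
    regroup = solve-∀

lemma9 : Σ ℕ λ a → Σ ℕ λ b → 0 < a × 0 < b ×
           ((q : ℕ) (hq : 2 ≤ q) (w : ℕ) → 1 ≤ w → (d : ℕ) →
            (alg : Fin (q ^ (2 ^ d)) → Alg q w) → Correct q hq w (2 ^ d) alg →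
            (j i : ℕ) → 1 ≤ j → j ≤ d → i < 2 ^ (d ∸ j) →
            a * δ q * 2 ^ j * (q ^ (2 ^ d) * q ^ (2 ^ d)) ≤ b * w * totalI q w (2 ^ d) alg j i)
lemma9 = 1 , transferConstant , z<s , z<s , λ q 2≤q w 1≤w d alg correct j i 1≤j j≤d i< →
  subst (λ a → a * 2 ^ j * (q ^ (2 ^ d) * q ^ (2 ^ d)) ≤ transferConstant * w * totalI q w (2 ^ d) alg j i)
        (sym (*-identityˡ (δ q))) (tree-lowerBound q 2≤q w 1≤w d alg correct j i 1≤j j≤d i<)
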